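{- For every $q\in\mathbb{N}$, the map \begin{align*} \bigcup_{a|q} {\mathcal Q}_{q,a} & \to \{ \Gamma n_+(\mathbf{r}) D(q) \mid \mathbf{r}\in{\mathcal R}_q \} \\ (c_1,c_2,b) & \mapsto \Gamma \begin{pmatrix} A& \mathbf{s} \\ {}^t\mathbf{0} & 1\end{pmatrix} \end{align*} is bijective, where \[ A=q^{ -\frac{1}{2}} \begin{pmatrix} a & b\\ 0 & \frac{q}{a}\end{pmatrix} , \qquad \mathbf{s} = q^{ -1} \begin{pmatrix} \overline{c_1} q_0\ell_0 + b\overline{c_2} q_1\ell_1 \\ \frac{q}{a} \overline{c_2}\end{pmatrix} , \] with $c_1\overline{c_1}\equiv 1\pmod{q_1}$, $c_2\overline{c_2}\equiv 1\pmod{q_0}$.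
   Context: Dimension $d=3$: $\Gamma=\operatorname{SL}_3(\mathbb{Z})$, $n_+(\mathbf{x})=\begin{pmatrix} 1_{2} & \mathbf{0} \\ {}^t\mathbf{x} & 1\end{pmatrix}$ for $\mathbf{x}\in\mathbb{R}^2$, $D(q)=\operatorname{diag}(\sqrt q,\sqrt q,q^{ -1})$, and ${\mathcal R}_q = \{ q^{ -1} \mathbf{p} : \mathbf{p}\in\mathbb{Z}^{2}\cap(0,q]^{2},\; \gcd(\mathbf{p},q)=1 \}$. For $a\mid q$: $q_0$ is the smallest positive divisor of $q$ with $a\mid q_0$ and $\gcd(q_0,q/q_0)=1$, $q_1=q/q_0$, and $\ell_0,\ell_1\in\mathbb{Z}$ satisfy $q_0\ell_0+q_1\ell_1=1$. Define \[ {\mathcal Q}_{q, a}=\left\{(c_1, c_2, b)\;:\; c_1\in (0, q_1],\ c_2\in (0, q_0],\ b\in (0, q/a],\ \gcd(c_1, q_1)=\gcd(c_2, q_0)=\gcd(b, \gcd(q/a, a))=1\right\}. \] -}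

module Defs where

open import Data.Nat as ℕ using (ℕ; zero; suc; _≤_; _<_; NonZero)
open import Data.Nat.Divisibility using (_∣_; _∣?_)
open import Data.Nat.GCD using (gcd)
open import Data.Nat.DivMod using (_/_)
open import Data.Integer as Z using (ℤ; +_)
import Data.Integer.Divisibility as ℤD
open import Data.Rational as Q using (ℚ)
open import Data.Fin using (Fin; zero; suc)
open import Data.Product using (Σ; ∃; _×_; _,_)
open import Relation.Binary.PropositionalEquality using (_≡_)
open import Relation.Nullary using (Dec; yes; no; _×-dec_)

Mat : Set → Set
Mat A = Fin 3 → Fin 3 → A

mat3 : {A : Set} → A → A → A → A → A → A → A → A → A → Mat A
mat3 x00 x01 x02 x10 x11 x12 x20 x21 x22 zero zero = x00
mat3 x00 x01 x02 x10 x11 x12 x20 x21 x22 zero (suc zero) = x01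
mat3 x00 x01 x02 x10 x11 x12 x20 x21 x22 zero (suc (suc zero)) = x02
mat3 x00 x01 x02 x10 x11 x12 x20 x21 x22 (suc zero) zero = x10
mat3 x00 x01 x02 x10 x11 x12 x20 x21 x22 (suc zero) (suc zero) = x11
mat3 x00 x01 x02 x10 x11 x12 x20 x21 x22 (suc zero) (suc (suc zero)) = x12
mat3 x00 x01 x02 x10 x11 x12 x20 x21 x22 (suc (suc zero)) zero = x20
mat3 x00 x01 x02 x10 x11 x12 x20 x21 x22 (suc (suc zero)) (suc zero) = x21
mat3 x00 x01 x02 x10 x11 x12 x20 x21 x22 (suc (suc zero)) (suc (suc zero)) = x22

detℤ : Mat ℤ → ℤ
detℤ m = let open Z using (_*_; _-_; _+_) in
    m zero zero * (m (suc zero) (suc zero) * m (suc (suc zero)) (suc (suc zero))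
                   - m (suc zero) (suc (suc zero)) * m (suc (suc zero)) (suc zero))
  - m zero (suc zero) * (m (suc zero) zero * m (suc (suc zero)) (suc (suc zero))
                   - m (suc zero) (suc (suc zero)) * m (suc (suc zero)) zero)
  + m zero (suc (suc zero)) * (m (suc zero) zero * m (suc (suc zero)) (suc zero)
                   - m (suc zero) (suc zero) * m (suc (suc zero)) zero)

InΓ : Mat ℤ → Set
InΓ γ = detℤ γ ≡ + 1

toℚ : ℤ → ℚ
toℚ z = z Q./ 1

_·_ : Mat ℤ → Mat ℚ → Mat ℚ
(γ · X) i j = let open Q using (_*_; _+_) in
  toℚ (γ i zero) * X zero j + toℚ (γ i (suc zero)) * X (suc zero) j
    + toℚ (γ i (suc (suc zero))) * X (suc (suc zero)) j

-- Every matrix occurring in the lemma has the form  g = X · Δ  with X rational and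
-- Δ = diag(q^{-1/2}, q^{-1/2}, 1).  Since right multiplication by Δ
-- is injective,  Γ (X Δ) = Γ (Y Δ)  iff  ∃ γ ∈ Γ, γ X = Y.
SameCoset : Mat ℚ → Mat ℚ → Set
SameCoset X Y = Σ (Mat ℤ) λ γ → InΓ γ × ((i j : Fin 3) → (γ · X) i j ≡ Y i j)

-- n₊(p/q) D(q) = X Δ with X below (p = (p₁,p₂))
nD : (q : ℕ) → .{{NonZero q}} → ℕ → ℕ → Mat ℚ
nD q p₁ p₂ = mat3 (toℚ (+ q)) Q.0ℚ Q.0ℚ
                  Q.0ℚ (toℚ (+ q)) Q.0ℚ
                  (toℚ (+ p₁)) (toℚ (+ p₂)) ((+ 1) Q./ q)

-- (p₁, p₂) gives an element q⁻¹ p of ℛ_q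
InR : ℕ → ℕ → ℕ → Set
InR q p₁ p₂ = (1 ≤ p₁ × p₁ ≤ q) × (1 ≤ p₂ × p₂ ≤ q) × gcd (gcd p₁ p₂) q ≡ 1

-- q₀(q,a): smallest positive divisor d of q with a ∣ d and gcd(d, q/d) = 1.
-- Searched over d = 1, 2, …; returned as suc of the predecessor (fallback q, but
-- d = q always qualifies when a ∣ q, q ≥ 1).
GoodQ0 : ℕ → ℕ → ℕ → Set
GoodQ0 q a k = (suc k ∣ q) × (a ∣ suc k) × (gcd (suc k) (q / suc k) ≡ 1)

goodQ0? : ∀ q a k → Dec (GoodQ0 q a k)
goodQ0? q a k = (suc k ∣? q) ×-dec ((a ∣? suc k) ×-dec (gcd (suc k) (q / suc k) ℕ.≟ 1))

searchQ0 : ℕ → ℕ → ℕ → ℕ → ℕ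
searchQ0 q a k zero = q ℕ.∸ 1
searchQ0 q a k (suc fuel) with goodQ0? q a k
... | yes _ = k
... | no _ = searchQ0 q a (suc k) fuel

q₀ : ℕ → ℕ → ℕ
q₀ q a = suc (searchQ0 q a 0 q)

q₁ : ℕ → ℕ → ℕ
q₁ q a = q / q₀ q a

-- (a, a', c₁, c₂, b) with a' = q/a encoded by a * a' ≡ q
record Tup : Set where
  constructor tup
  field
    a a' c₁ c₂ b : ℕ

InQ : ℕ → Tup → Set
InQ q (tup a a' c₁ c₂ b) =
  (a ℕ.* a' ≡ q)
  × (1 ≤ c₁ × c₁ ≤ q₁ q a) × (1 ≤ c₂ × c₂ ≤ q₀ q a) × (1 ≤ b × b ≤ a')
  × gcd c₁ (q₁ q a) ≡ 1 × gcd c₂ (q₀ q a) ≡ 1 × gcd b (gcd a' a) ≡ 1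

-- the image matrix X with  (A s; 0 1) = X Δ
--   ℓ₀ ℓ₁ : choices of Bézout coefficients (depending on a)
--   inv₁ inv₂ : choices of inverses c̄₁ mod q₁, c̄₂ mod q₀ (depending on a and c)
imageMat : (q : ℕ) → .{{NonZero q}} → (ℓ₀ ℓ₁ : ℕ → ℤ) → (inv₁ inv₂ : ℕ → ℕ → ℤ) → Tup → Mat ℚ
imageMat q ℓ₀ ℓ₁ inv₁ inv₂ (tup a a' c₁ c₂ b) =
  let open Z using (_*_; _-_; _+_) in
  mat3 (toℚ (+ a)) (toℚ (+ b))
         ((inv₁ a c₁ * + q₀ q a * ℓ₀ a + + b * inv₂ a c₂ * + q₁ q a * ℓ₁ a) Q./ q)
       Q.0ℚ (toℚ (+ a')) ((+ a' * inv₂ a c₂) Q./ q)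
       Q.0ℚ Q.0ℚ Q.1ℚ

{-# OPTIONS --safe #-}
module Submission where

-- Once the factor diag(q^{-1/2}, q^{-1/2}, 1) common to all matrices is split off (as in
-- SameCoset), multiplying by q clears every denominator, and Γ g = Γ n₊(r) D(q) becomes
-- γ X = Y for some γ ∈ SL₃(ℤ), with X, Y the integral upper and lower forms below.
-- Everything then reduces to congruences:
--   the image lies in ℛ_q because s̄₁, a′c̄₂ and q are coprime, so a Bézout vector is the
--   last row of γ = (a′ −b x; 0 a −c̄₂; G₀ G₁ G₂), and p = (G₀ a, G₀ b + G₁ a′) mod q;
--   every p is hit: take a = gcd(p₁, q) and read b, c₁, c₂ off p modulo a′, q₁ and q₀;
--   the map is injective: a γ between two upper forms is unipotent, so a and b agree and
--   the s-entries agree modulo q, which fixes c̄₁ modulo q₁ and c̄₂ modulo q₀.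
-- The one fact about q₀ that is used is that, by minimality, its only divisor prime to a
-- is 1.

open import Defs
open import Data.Nat as ℕ using (ℕ; zero; suc; _≤_; _<_; NonZero; s≤s; z≤n)
import Data.Nat.Properties as ℕₚ
open import Data.Nat.Divisibility using (_∣_)
import Data.Nat.Divisibility as ℕD
open import Data.Nat.GCD using (gcd)
import Data.Nat.GCD as ℕG
import Data.Nat.Coprimality as ℕC
open ℕC using (Coprime)
import Data.Nat.DivMod as ℕDM
open import Data.Integer using (ℤ; +_; -[1+_]; _*_; _+_; _-_; -_; ∣_∣)
import Data.Integer.Properties as ℤₚ
import Data.Integer.DivMod as ℤD
open import Data.Integer.Divisibility using () renaming (_∣_ to _∣ℤ_)
open import Data.Integer.Divisibility.Signed as ℤ∣ using (divides) renaming (_∣_ to _∣ᶻ_)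
open import Data.Integer.Tactic.RingSolver using (solve-∀)
open import Data.Rational as ℚ using (ℚ)
import Data.Rational.Properties as ℚₚ
import Data.Rational.Unnormalised as ℚᵘ
import Data.Rational.Unnormalised.Properties as ℚᵘₚ
open import Data.Fin using (Fin; zero; suc)
open import Data.Product using (Σ; _×_; _,_; proj₁; proj₂)
open import Data.Sum using (inj₁; inj₂)
open import Data.Empty using (⊥; ⊥-elim)
open import Relation.Nullary using (¬_; yes; no)
open import Relation.Binary.PropositionalEquality

-- Integer arithmetic

-- Ring identities that hold only modulo hypotheses u ≡ v are proved by letting the
-- solver check  L ≡ R + α * (u - v)  and then dropping the vanishing term.
drop-vanishing : ∀ {L R u v} α → L ≡ R + α * (u - v) → u ≡ v → L ≡ R
drop-vanishing {R = R} {u} α e refl = trans e (vanish R α u)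
  where
  vanish : ∀ R α u → R + α * (u - u) ≡ R
  vanish = solve-∀

drop-vanishing₂ : ∀ {L R u v u′ v′} α β → L ≡ R + α * (u - v) + β * (u′ - v′)
  → u ≡ v → u′ ≡ v′ → L ≡ R
drop-vanishing₂ {R = R} {u} {u′ = u′} α β e refl refl = trans e (vanish R α u β u′)
  where
  vanish : ∀ R α u β u′ → R + α * (u - u) + β * (u′ - u′) ≡ R
  vanish = solve-∀

drop-vanishing₃ : ∀ {L R u v u′ v′ u″ v″} α β γ
  → L ≡ R + α * (u - v) + β * (u′ - v′) + γ * (u″ - v″)
  → u ≡ v → u′ ≡ v′ → u″ ≡ v″ → L ≡ R
drop-vanishing₃ {R = R} {u} {u′ = u′} {u″ = u″} α β γ e refl refl refl =
  trans e (vanish R α u β u′ γ u″)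
  where
  vanish : ∀ R α u β u′ γ u″ → R + α * (u - u) + β * (u′ - u′) + γ * (u″ - u″) ≡ R
  vanish = solve-∀

∣-resp-≡ : ∀ {d x y} → x ≡ y → d ∣ᶻ x → d ∣ᶻ y
∣-resp-≡ refl d∣x = d∣x

∣-lincomb : ∀ {d x y} α β → d ∣ᶻ x → d ∣ᶻ y → d ∣ᶻ α * x + β * y
∣-lincomb α β d∣x d∣y = ℤ∣.∣m∣n⇒∣m+n (ℤ∣.∣n⇒∣m*n α d∣x) (ℤ∣.∣n⇒∣m*n β d∣y)

∣-lincomb₃ : ∀ {d x y z} α β γ → d ∣ᶻ x → d ∣ᶻ y → d ∣ᶻ z → d ∣ᶻ α * x + β * y + γ * z
∣-lincomb₃ α β γ d∣x d∣y d∣z = ℤ∣.∣m∣n⇒∣m+n (∣-lincomb α β d∣x d∣y) (ℤ∣.∣n⇒∣m*n γ d∣z)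

∣-congruentˡ : ∀ {g n s t} → n ∣ᶻ s - t → g ∣ᶻ n → g ∣ᶻ s → g ∣ᶻ t
∣-congruentˡ {s = s} {t} n∣s-t g∣n g∣s =
  ∣-resp-≡ (identity s t) (∣-lincomb (+ 1) (- + 1) g∣s (ℤ∣.∣-trans g∣n n∣s-t))
  where
  identity : ∀ s t → (+ 1) * s + (- + 1) * (s - t) ≡ t
  identity = solve-∀

∣-congruentʳ : ∀ {g n s t} → n ∣ᶻ t - s → g ∣ᶻ n → g ∣ᶻ s → g ∣ᶻ t
∣-congruentʳ {s = s} {t} n∣t-s g∣n g∣s =
  ∣-resp-≡ (identity s t) (∣-lincomb (+ 1) (+ 1) g∣s (ℤ∣.∣-trans g∣n n∣t-s))
  where
  identity : ∀ s t → (+ 1) * s + (+ 1) * (t - s) ≡ t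
  identity = solve-∀

∣-unit-cancel : ∀ {g n c I y} → g ∣ᶻ n → n ∣ᶻ c * I - + 1 → g ∣ᶻ y * I → g ∣ᶻ y
∣-unit-cancel {c = c} {I} {y} g∣n n∣cI-1 g∣yI =
  ∣-resp-≡ (identity c I y) (∣-lincomb c (- y) g∣yI (ℤ∣.∣-trans g∣n n∣cI-1))
  where
  identity : ∀ c I y → c * (y * I) + (- y) * (c * I - + 1) ≡ y
  identity = solve-∀

congruent-shift : ∀ {n s s′ t t′} g Q → n ∣ᶻ s′ - t′ → n ∣ᶻ s - t → n ∣ᶻ Q → s′ ≡ s + g * Q → n ∣ᶻ t′ - t
congruent-shift {s = s} {s′} {t} {t′} g Q n∣s′-t′ n∣s-t n∣Q s′≡ =
  ∣-resp-≡ (drop-vanishing (- + 1) (identity s s′ t t′ g Q) s′≡) (∣-lincomb₃ (- + 1) (+ 1) g n∣s′-t′ n∣s-t n∣Q)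
  where
  identity : ∀ s s′ t t′ g Q → (- + 1) * (s′ - t′) + (+ 1) * (s - t) + g * Q ≡ t′ - t + (- + 1) * (s′ - (s + g * Q))
  identity = solve-∀

inverses-congruent : ∀ {n} c C I J → n ∣ᶻ C * J - + 1 → n ∣ᶻ c * I - + 1 → n ∣ᶻ J - I → n ∣ᶻ c - C
inverses-congruent c C I J n∣CJ-1 n∣cI-1 n∣J-I =
  ∣-resp-≡ (identity c C I J) (∣-lincomb₃ (- c) C (c * C) n∣CJ-1 n∣cI-1 n∣J-I)
  where
  identity : ∀ c C I J → (- c) * (C * J - + 1) + C * (c * I - + 1) + c * C * (J - I) ≡ c - C
  identity = solve-∀

∣1⇒∣∣≡1 : ∀ {d} → d ∣ᶻ + 1 → ∣ d ∣ ≡ 1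
∣1⇒∣∣≡1 d∣1 = ℕD.∣1⇒≡1 (ℤ∣.∣⇒∣ᵤ d∣1)

∣∣≡1⇒∣1 : ∀ {d} → ∣ d ∣ ≡ 1 → d ∣ᶻ + 1
∣∣≡1⇒∣1 e = ℤ∣.∣ᵤ⇒∣ (subst (_∣ 1) (sym e) ℕD.∣-refl)

Coprimeℤ : ℤ → ℤ → Set
Coprimeℤ x y = ∀ {d} → d ∣ᶻ x → d ∣ᶻ y → d ∣ᶻ + 1

Coprimeℤ₃ : ℤ → ℤ → ℤ → Set
Coprimeℤ₃ x y z = ∀ {d} → d ∣ᶻ x → d ∣ᶻ y → d ∣ᶻ z → d ∣ᶻ + 1

gcd≡1⇒coprimeℤ : ∀ {m n} → gcd m n ≡ 1 → Coprimeℤ (+ m) (+ n)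
gcd≡1⇒coprimeℤ g d∣m d∣n = ∣∣≡1⇒∣1 (ℕC.gcd≡1⇒coprime g (ℤ∣.∣⇒∣ᵤ d∣m , ℤ∣.∣⇒∣ᵤ d∣n))

coprimeℤ⇒gcd≡1 : ∀ {m n} → Coprimeℤ (+ m) (+ n) → gcd m n ≡ 1
coprimeℤ⇒gcd≡1 {m} {n} c =
  ∣1⇒∣∣≡1 (c {+ gcd m n} (ℤ∣.∣ᵤ⇒∣ (ℕG.gcd[m,n]∣m m n)) (ℤ∣.∣ᵤ⇒∣ (ℕG.gcd[m,n]∣n m n)))

gcd≡1⇒coprimeℤ₃ : ∀ {m n o} → gcd (gcd m n) o ≡ 1 → Coprimeℤ₃ (+ m) (+ n) (+ o)
gcd≡1⇒coprimeℤ₃ g d∣m d∣n d∣o = gcd≡1⇒coprimeℤ g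
  (ℤ∣.∣-trans ℤ∣.m∣∣m∣ (ℤ∣.∣ᵤ⇒∣ (ℕG.gcd-greatest (ℤ∣.∣⇒∣ᵤ d∣m) (ℤ∣.∣⇒∣ᵤ d∣n)))) d∣o

bézout⇒coprimeℤ : ∀ {u x v y} → u * x + v * y ≡ + 1 → Coprimeℤ x y
bézout⇒coprimeℤ {u} {v = v} e d∣x d∣y = ∣-resp-≡ e (∣-lincomb u v d∣x d∣y)

private
  gcdℤ : ℤ → ℤ → ℤ
  gcdℤ x y = + gcd (∣ x ∣) (∣ y ∣)

  gcdℤ∣ˡ : ∀ x y → gcdℤ x y ∣ᶻ x
  gcdℤ∣ˡ x y = ℤ∣.∣ᵤ⇒∣ (ℕG.gcd[m,n]∣m (∣ x ∣) (∣ y ∣))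

  gcdℤ∣ʳ : ∀ x y → gcdℤ x y ∣ᶻ y
  gcdℤ∣ʳ x y = ℤ∣.∣ᵤ⇒∣ (ℕG.gcd[m,n]∣n (∣ x ∣) (∣ y ∣))

  abs-as-multiple : ∀ x → Σ ℤ λ σ → σ * x ≡ + ∣ x ∣
  abs-as-multiple (+ n)    = + 1 , ℤₚ.*-identityˡ (+ n)
  abs-as-multiple -[1+ n ] = - + 1 , ℤₚ.-1*i≡-i -[1+ n ]

  pos-+-* : ∀ {g b n a m} → g ℕ.+ b ℕ.* n ≡ a ℕ.* m → + g + + b * + n ≡ + a * + m
  pos-+-* {g} {b} {n} {a} {m} e = begin
    + g + + b * + n    ≡⟨ cong (λ t → + g + t) (ℤₚ.pos-* b n) ⟨
    + g + + (b ℕ.* n)  ≡⟨ ℤₚ.pos-+ g (b ℕ.* n) ⟨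
    + (g ℕ.+ b ℕ.* n)  ≡⟨ cong +_ e ⟩
    + (a ℕ.* m)        ≡⟨ ℤₚ.pos-* a m ⟩
    + a * + m          ∎
    where open ≡-Reasoning

  +⇒≡- : ∀ {g t s} → g + t ≡ s → g ≡ s - t
  +⇒≡- {g} {t} refl = sym (cancel g t)
    where
    cancel : ∀ g t → g + t - t ≡ g
    cancel = solve-∀

bézout-gcd : ∀ x y → Σ ℤ λ u → Σ ℤ λ v → u * x + v * y ≡ gcdℤ x y
bézout-gcd x y with abs-as-multiple x | abs-as-multiple y
                  | ℕG.Bézout.identity (ℕG.gcd-GCD (∣ x ∣) (∣ y ∣))
... | σ , σx | τ , τy | ℕG.Bézout.+- a b e = + a * σ , - (+ b * τ) , (begin
  + a * σ * x + - (+ b * τ) * y  ≡⟨ regroup (+ a) σ x (+ b) τ y ⟩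
  + a * (σ * x) - + b * (τ * y)  ≡⟨ cong₂ (λ s t → + a * s - + b * t) σx τy ⟩
  + a * + ∣ x ∣ - + b * + ∣ y ∣  ≡⟨ +⇒≡- (pos-+-* {b = b} {∣ y ∣} {a} {∣ x ∣} e) ⟨
  gcdℤ x y                       ∎)
  where
  open ≡-Reasoning
  regroup : ∀ a σ x b τ y → a * σ * x + - (b * τ) * y ≡ a * (σ * x) - b * (τ * y)
  regroup = solve-∀
... | σ , σx | τ , τy | ℕG.Bézout.-+ a b e = - (+ a * σ) , + b * τ , (begin
  - (+ a * σ) * x + + b * τ * y  ≡⟨ regroup (+ a) σ x (+ b) τ y ⟩
  + b * (τ * y) - + a * (σ * x)  ≡⟨ cong₂ (λ s t → + b * t - + a * s) σx τy ⟩
  + b * + ∣ y ∣ - + a * + ∣ x ∣  ≡⟨ +⇒≡- (pos-+-* {b = a} {∣ x ∣} {b} {∣ y ∣} e) ⟨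
  gcdℤ x y                       ∎)
  where
  open ≡-Reasoning
  regroup : ∀ a σ x b τ y → - (a * σ) * x + b * τ * y ≡ b * (τ * y) - a * (σ * x)
  regroup = solve-∀

coprimeℤ⇒bézout : ∀ x y → Coprimeℤ x y → Σ ℤ λ u → Σ ℤ λ v → u * x + v * y ≡ + 1
coprimeℤ⇒bézout x y c with bézout-gcd x y
... | u , v , e = u , v , trans e (cong +_ (∣1⇒∣∣≡1 (c (gcdℤ∣ˡ x y) (gcdℤ∣ʳ x y))))

coprimeℤ₃⇒bézout : ∀ x y z → Coprimeℤ₃ x y z
  → Σ ℤ λ u → Σ ℤ λ v → Σ ℤ λ w → u * x + v * y + w * z ≡ + 1
coprimeℤ₃⇒bézout x y z c with bézout-gcd x y
... | u , v , e with coprimeℤ⇒bézout (gcdℤ x y) z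
                       (λ d∣g d∣z → c (ℤ∣.∣-trans d∣g (gcdℤ∣ˡ x y)) (ℤ∣.∣-trans d∣g (gcdℤ∣ʳ x y)) d∣z)
... | α , β , e′ = α * u , α * v , β , trans (distrib α u x v y β z) (trans (cong (λ t → α * t + β * z) e) e′)
  where
  distrib : ∀ α u x v y β z → α * u * x + α * v * y + β * z ≡ α * (u * x + v * y) + β * z
  distrib = solve-∀

coprimeℤ-divisor : ∀ {n x z} → Coprimeℤ n x → n ∣ᶻ x * z → n ∣ᶻ z
coprimeℤ-divisor {n} {x} {z} c n∣xz with coprimeℤ⇒bézout n x c
... | u , v , e = ∣-resp-≡ (drop-vanishing z (identity u n v x z) e) (∣-lincomb (u * z) v ℤ∣.∣-refl n∣xz)
  where
  identity : ∀ u n v x z → u * z * n + v * (x * z) ≡ z + z * (u * n + v * x - + 1)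
  identity = solve-∀

coprimeℤ₃-divisor : ∀ {n x y z} → Coprimeℤ₃ n x y → n ∣ᶻ x * z → n ∣ᶻ y * z → n ∣ᶻ z
coprimeℤ₃-divisor {n} {x} {y} {z} c n∣xz n∣yz = combine (coprimeℤ₃⇒bézout n x y c)
  where
  identity : ∀ u n v x w y z → u * z * n + v * (x * z) + w * (y * z) ≡ z + z * (u * n + v * x + w * y - + 1)
  identity = solve-∀
  combine : (Σ ℤ λ u → Σ ℤ λ v → Σ ℤ λ w → u * n + v * x + w * y ≡ + 1) → n ∣ᶻ z
  combine (u , v , w , e) = ∣-resp-≡ (drop-vanishing z (identity u n v x w y z) e)
    (∣-lincomb₃ (u * z) v w ℤ∣.∣-refl n∣xz n∣yz)

coprimeℤ-∣⇒*-∣ : ∀ {m n z} → Coprimeℤ m n → n ∣ᶻ z → m ∣ᶻ z → m * n ∣ᶻ z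
coprimeℤ-∣⇒*-∣ {m} {n} {z} c (divides k z≡kn) m∣z =
  quotient (coprimeℤ-divisor {x = n} {z = k} c (∣-resp-≡ (trans z≡kn (ℤₚ.*-comm k n)) m∣z))
  where
  quotient : m ∣ᶻ k → m * n ∣ᶻ z
  quotient (divides l k≡lm) = divides l (trans z≡kn (trans (cong (_* n) k≡lm) (ℤₚ.*-assoc l m n)))

Representative : ℤ → ℕ → Set
Representative z n = Σ ℕ λ p → (1 ≤ p × p ≤ n) × Σ ℤ λ k → z - + p ≡ k * + n

representative : ∀ z n .{{_ : NonZero n}} → Representative z n
representative z n = shift ((z - + 1) ℤD.%ℕ n) ((z - + 1) ℤD./ℕ n) (ℤD.n%ℕd<d (z - + 1) n) (ℤD.a≡a%ℕn+[a/ℕn]*n (z - + 1) n)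
  where
  shift : ∀ r k → r < n → z - + 1 ≡ + r + k * + n → Representative z n
  shift r k r<n e = suc r , (s≤s z≤n , r<n) , k , drop-vanishing (+ 1) (identity z (+ r) k (+ n)) e
    where
    identity : ∀ z r k n → z - (+ 1 + r) ≡ k * n + (+ 1) * ((z - + 1) - (r + k * n))
    identity = solve-∀

private
  multiple-below⇒≡0 : ∀ {n m} → n ∣ m → m < n → m ≡ 0
  multiple-below⇒≡0 {m = zero}  _   _   = refl
  multiple-below⇒≡0 {m = suc m} n∣m m<n = ⊥-elim (ℕₚ.<⇒≱ m<n (ℕD.∣⇒≤ n∣m))

  congruent-≤-in-range : ∀ {n x y} → 1 ≤ x → y ≤ n → x ≤ y → + n ∣ᶻ + x - + y → y ≤ x
  congruent-≤-in-range {n} {x} {y} 1≤x y≤n x≤y n∣x-y = ℕₚ.m∸n≡0⇒m≤n (multiple-below⇒≡0 n∣y∸x y∸x<n)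
    where
    n∣y∸x : n ∣ y ℕ.∸ x
    n∣y∸x = subst (n ∣_) (trans (cong ∣_∣ (ℤₚ.[+m]-[+n]≡m⊖n x y)) (ℤₚ.∣⊖∣-≤ x≤y)) (ℤ∣.∣⇒∣ᵤ n∣x-y)
    y∸x<n : y ℕ.∸ x < n
    y∸x<n = ℕₚ.<-≤-trans (ℕₚ.∸-monoʳ-< 1≤x x≤y) y≤n

congruent-in-range⇒≡ : ∀ {n x y} → 1 ≤ x → x ≤ n → 1 ≤ y → y ≤ n → + n ∣ᶻ + x - + y → x ≡ y
congruent-in-range⇒≡ {n} {x} {y} 1≤x x≤n 1≤y y≤n n∣x-y with ℕₚ.≤-total x y
... | inj₁ x≤y = ℕₚ.≤-antisym x≤y (congruent-≤-in-range 1≤x y≤n x≤y n∣x-y)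
... | inj₂ y≤x = ℕₚ.≤-antisym (congruent-≤-in-range 1≤y x≤n y≤x n∣y-x) y≤x
  where
  negate : ∀ x y → - (x - y) ≡ y - x
  negate = solve-∀
  n∣y-x : + n ∣ᶻ + y - + x
  n∣y-x = ∣-resp-≡ (negate (+ x) (+ y)) (ℤ∣.∣m⇒∣-m n∣x-y)

-- The divisor q₀

coprime-*ˡ : ∀ {x y a} → Coprime x a → Coprime y a → Coprime (x ℕ.* y) a
coprime-*ˡ {x} {y} cx cy {i} (i∣xy , i∣a) = cy (ℕC.coprime-divisor i⊥x i∣xy , i∣a)
  where
  i⊥x : Coprime i x
  i⊥x (g∣i , g∣x) = cx (g∣x , ℕD.∣-trans g∣i i∣a)

searchQ0-least : ∀ q a k fuel → Σ ℕ (λ j → k ≤ j × j < k ℕ.+ fuel × GoodQ0 q a j)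
  → GoodQ0 q a (searchQ0 q a k fuel)
  × (∀ j → k ≤ j → j < searchQ0 q a k fuel → ¬ GoodQ0 q a j)
searchQ0-least q a k zero (j , k≤j , j<k+0 , _) =
  ⊥-elim (ℕₚ.<⇒≱ (subst (j <_) (ℕₚ.+-identityʳ k) j<k+0) k≤j)
searchQ0-least q a k (suc fuel) (j , k≤j , j<k+1+fuel , good-j) with goodQ0? q a k
... | yes good-k = good-k , λ j′ k≤j′ j′<k → ⊥-elim (ℕₚ.<⇒≱ j′<k k≤j′)
... | no ¬good-k = proj₁ rest , below
  where
  k<j : k < j
  k<j with ℕₚ.m≤n⇒m<n∨m≡n k≤j
  ... | inj₁ k<j = k<j
  ... | inj₂ refl = ⊥-elim (¬good-k good-j)
  rest : GoodQ0 q a (searchQ0 q a (suc k) fuel) × (∀ j → suc k ≤ j → j < searchQ0 q a (suc k) fuel → ¬ GoodQ0 q a j)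
  rest = searchQ0-least q a (suc k) fuel (j , k<j , subst (j <_) (ℕₚ.+-suc k fuel) j<k+1+fuel , good-j)
  below : ∀ j′ → k ≤ j′ → j′ < searchQ0 q a (suc k) fuel → ¬ GoodQ0 q a j′
  below j′ k≤j′ j′<s with ℕₚ.m≤n⇒m<n∨m≡n k≤j′
  ... | inj₁ k<j′ = proj₂ rest j′ k<j′ j′<s
  ... | inj₂ refl = ¬good-k

module DivisorQ₀ (k a : ℕ) (a∣q : a ∣ suc k) where

  private
    q Q₀ Q₁ : ℕ
    q = suc k
    Q₀ = q₀ q a
    Q₁ = q₁ q a

    search : GoodQ0 q a (searchQ0 q a 0 q) × (∀ j → 0 ≤ j → j < searchQ0 q a 0 q → ¬ GoodQ0 q a j)
    search = searchQ0-least q a 0 q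
      (k , z≤n , ℕₚ.≤-refl , ℕD.∣-refl , a∣q , subst (λ n → gcd q n ≡ 1) (sym (ℕDM.n/n≡1 q)) (ℕG.gcd-zeroʳ q))

  q₀∣q : Q₀ ∣ q
  q₀∣q = proj₁ (proj₁ search)

  a∣q₀ : a ∣ Q₀
  a∣q₀ = proj₁ (proj₂ (proj₁ search))

  coprime-q₀-q₁ : Coprime Q₀ Q₁
  coprime-q₀-q₁ = ℕC.gcd≡1⇒coprime (proj₂ (proj₂ (proj₁ search)))

  q₀*q₁≡q : Q₀ ℕ.* Q₁ ≡ q
  q₀*q₁≡q = ℕDM.m*[n/m]≡n q₀∣q

  q₀-least : ∀ j → GoodQ0 q a j → Q₀ ≤ suc j
  q₀-least j good-j with ℕₚ.<-≤-connex j (searchQ0 q a 0 q)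
  ... | inj₁ j<s = ⊥-elim (proj₂ search j z≤n j<s good-j)
  ... | inj₂ s≤j = s≤s s≤j

  private
    -- If q₀ = w d with d ≥ 2 prime to a and to w, then w < q₀ would also be admissible.
    coprime-cofactor-admissible : ∀ d w → 2 ≤ d → Coprime d a → Q₀ ≡ w ℕ.* d → gcd d w ≡ 1 → ⊥
    coprime-cofactor-admissible d zero _ _ () _
    coprime-cofactor-admissible d w@(suc j) 2≤d d⊥a Q₀≡wd gcd≡1 =
      ℕₚ.<⇒≱ w<Q₀ (q₀-least j (w∣q , a∣w , gcd[w,q/w]≡1))
      where
      w∣Q₀ : w ∣ Q₀
      w∣Q₀ = ℕD.divides d (trans Q₀≡wd (ℕₚ.*-comm w d))
      w∣q : w ∣ q
      w∣q = ℕD.∣-trans w∣Q₀ q₀∣q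
      a∣w : a ∣ w
      a∣w = ℕC.coprime-divisor (ℕC.sym d⊥a) (subst (a ∣_) (trans Q₀≡wd (ℕₚ.*-comm w d)) a∣q₀)
      q≡dQ₁*w : q ≡ (d ℕ.* Q₁) ℕ.* w
      q≡dQ₁*w = begin
        q                    ≡⟨ q₀*q₁≡q ⟨
        Q₀ ℕ.* Q₁            ≡⟨ cong (ℕ._* Q₁) Q₀≡wd ⟩
        w ℕ.* d ℕ.* Q₁       ≡⟨ ℕₚ.*-assoc w d Q₁ ⟩
        w ℕ.* (d ℕ.* Q₁)     ≡⟨ ℕₚ.*-comm w (d ℕ.* Q₁) ⟩
        d ℕ.* Q₁ ℕ.* w       ∎
        where open ≡-Reasoning
      w⊥dQ₁ : Coprime w (d ℕ.* Q₁)
      w⊥dQ₁ = ℕC.sym (coprime-*ˡ {d} (ℕC.gcd≡1⇒coprime gcd≡1)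
                (λ (i∣Q₁ , i∣w) → coprime-q₀-q₁ (ℕD.∣-trans i∣w w∣Q₀ , i∣Q₁)))
      gcd[w,q/w]≡1 : gcd w (q ℕDM./ w) ≡ 1
      gcd[w,q/w]≡1 = subst (λ n → gcd w (n ℕDM./ w) ≡ 1) (sym q≡dQ₁*w)
        (subst (λ n → gcd w n ≡ 1) (sym (ℕDM.m*n/n≡m (d ℕ.* Q₁) w)) (ℕC.coprime⇒gcd≡1 w⊥dQ₁))
      w<Q₀ : w < Q₀
      w<Q₀ = subst (w <_) (sym Q₀≡wd) (ℕₚ.m<m*n w d 2≤d)

    -- Otherwise d can be replaced by the strictly larger d · gcd(d, w); the
    -- fuel n bounds the number of such steps.
    no-divisor-coprime-to-a : ∀ n d → 2 ≤ d → d ∣ Q₀ → Coprime d a → Q₀ ≤ d ℕ.+ n → ⊥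
    no-divisor-coprime-to-a n d 2≤d (ℕD.divides w Q₀≡wd) d⊥a Q₀≤d+n with gcd d w ℕ.≟ 1
    ... | yes gcd≡1 = coprime-cofactor-admissible d w 2≤d d⊥a Q₀≡wd gcd≡1
    ... | no gcd≢1 = enlarge n Q₀≤d+n
      where
      g d′ : ℕ
      g = gcd d w
      d′ = d ℕ.* g
      2≤g : 2 ≤ g
      2≤g = ≢0∧≢1⇒≥2 (ℕG.gcd[m,n]≢0 d w (inj₁ λ { refl → ℕₚ.<⇒≱ 2≤d z≤n })) gcd≢1
        where
        ≢0∧≢1⇒≥2 : ∀ {n} → n ≢ 0 → n ≢ 1 → 2 ≤ n
        ≢0∧≢1⇒≥2 {zero} n≢0 _ = ⊥-elim (n≢0 refl)
        ≢0∧≢1⇒≥2 {suc zero} _ n≢1 = ⊥-elim (n≢1 refl)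
        ≢0∧≢1⇒≥2 {suc (suc _)} _ _ = s≤s (s≤s z≤n)
      d<d′ : d < d′
      d<d′ = ℕₚ.m<m*n d g 2≤g
        where instance _ = ℕ.>-nonZero (ℕₚ.<-≤-trans (s≤s z≤n) 2≤d)
      d′∣Q₀ : d′ ∣ Q₀
      d′∣Q₀ = subst (d′ ∣_) (sym (trans Q₀≡wd (ℕₚ.*-comm w d))) (ℕD.*-monoʳ-∣ d (ℕG.gcd[m,n]∣n d w))
      d′⊥a : Coprime d′ a
      d′⊥a = coprime-*ˡ d⊥a (λ (i∣g , i∣a) → d⊥a (ℕD.∣-trans i∣g (ℕG.gcd[m,n]∣m d w) , i∣a))
      enlarge : ∀ n → Q₀ ≤ d ℕ.+ n → ⊥
      enlarge zero Q₀≤d+0 = ℕₚ.<⇒≱ (ℕₚ.≤-<-trans (subst (Q₀ ≤_) (ℕₚ.+-identityʳ d) Q₀≤d+0) d<d′) (ℕD.∣⇒≤ d′∣Q₀)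
      enlarge (suc n) Q₀≤d+1+n = no-divisor-coprime-to-a n d′ (ℕₚ.≤-trans 2≤d (ℕₚ.<⇒≤ d<d′)) d′∣Q₀ d′⊥a
        (ℕₚ.≤-trans Q₀≤d+1+n (subst (ℕ._≤ d′ ℕ.+ n) (sym (ℕₚ.+-suc d n)) (ℕₚ.+-monoˡ-≤ n d<d′)))

  divisor-of-q₀-coprime-to-a : ∀ d → d ∣ Q₀ → Coprime d a → d ≡ 1
  divisor-of-q₀-coprime-to-a zero 0∣Q₀ _ with ℕD.0∣⇒≡0 0∣Q₀
  ... | ()
  divisor-of-q₀-coprime-to-a (suc zero) _ _ = refl
  divisor-of-q₀-coprime-to-a d@(suc (suc _)) d∣Q₀ d⊥a =
    ⊥-elim (no-divisor-coprime-to-a Q₀ d (s≤s (s≤s z≤n)) d∣Q₀ d⊥a (ℕₚ.m≤n+m Q₀ d))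

-- Integral cosets

_≐_ : {A : Set} → Mat A → Mat A → Set
X ≐ Y = ∀ i j → X i j ≡ Y i j

infix 4 _≐_

_⊗_ : Mat ℤ → Mat ℤ → Mat ℤ
(γ ⊗ M) i j = γ i zero * M zero j + γ i (suc zero) * M (suc zero) j + γ i (suc (suc zero)) * M (suc (suc zero)) j

IntegralCoset : Mat ℤ → Mat ℤ → Set
IntegralCoset M N = Σ (Mat ℤ) λ γ → InΓ γ × γ ⊗ M ≐ N

·-congʳ : ∀ γ {X Y} → X ≐ Y → γ · X ≐ γ · Y
·-congʳ γ X≐Y i j rewrite X≐Y zero j | X≐Y (suc zero) j | X≐Y (suc (suc zero)) j = refl

module Scaling (k : ℕ) where

  scaled : Mat ℤ → Mat ℚ
  scaled M i j = M i j ℚ./ suc k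

  private
    open ℚᵘₚ using (≃-trans; ≃-sym)

    toℚᵘ-/ : ∀ x → ℚ.toℚᵘ (x ℚ./ suc k) ℚᵘ.≃ ℚᵘ.mkℚᵘ x k
    toℚᵘ-/ x = ℚₚ.toℚᵘ-fromℚᵘ (ℚᵘ.mkℚᵘ x k)

    toℚᵘ-toℚ : ∀ x → ℚ.toℚᵘ (toℚ x) ℚᵘ.≃ ℚᵘ.mkℚᵘ x 0
    toℚᵘ-toℚ x = ℚₚ.toℚᵘ-fromℚᵘ (ℚᵘ.mkℚᵘ x 0)

    toℚᵘ-*-/ : ∀ g m → ℚ.toℚᵘ (toℚ g ℚ.* (m ℚ./ suc k)) ℚᵘ.≃ ℚᵘ.mkℚᵘ (g * m) k
    toℚᵘ-*-/ g m = ≃-trans (ℚₚ.toℚᵘ-homo-* (toℚ g) (m ℚ./ suc k))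
      (≃-trans (ℚᵘₚ.*-cong (toℚᵘ-toℚ g) (toℚᵘ-/ m))
               (ℚᵘ.*≡* (cong (λ n → g * m * + n) (sym (ℕₚ.*-identityˡ (suc k))))))

    toℚᵘ-+-/ : ∀ P R x y → ℚ.toℚᵘ P ℚᵘ.≃ ℚᵘ.mkℚᵘ x k → ℚ.toℚᵘ R ℚᵘ.≃ ℚᵘ.mkℚᵘ y k
      → ℚ.toℚᵘ (P ℚ.+ R) ℚᵘ.≃ ℚᵘ.mkℚᵘ (x + y) k
    toℚᵘ-+-/ P R x y P≃x R≃y = ≃-trans (ℚₚ.toℚᵘ-homo-+ P R) (≃-trans (ℚᵘₚ.+-cong P≃x R≃y)
      (ℚᵘ.*≡* (trans (common-denominator x y (+ suc k)) (cong ((x + y) *_) (sym (ℤₚ.pos-* (suc k) (suc k)))))))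
      where
      common-denominator : ∀ x y s → (x * s + y * s) * s ≡ (x + y) * (s * s)
      common-denominator = solve-∀

  ·-scaled : ∀ γ M → γ · scaled M ≐ scaled (γ ⊗ M)
  ·-scaled γ M i j = ℚₚ.toℚᵘ-injective (≃-trans
    (toℚᵘ-+-/ _ _ _ _ (toℚᵘ-+-/ _ _ _ _ (toℚᵘ-*-/ (γ i zero) (M zero j)) (toℚᵘ-*-/ (γ i (suc zero)) (M (suc zero) j)))
                      (toℚᵘ-*-/ (γ i (suc (suc zero))) (M (suc (suc zero)) j)))
    (≃-sym (toℚᵘ-/ _)))

  /-injective : ∀ x y → x ℚ./ suc k ≡ y ℚ./ suc k → x ≡ y
  /-injective x y e with ≃-trans (≃-sym (toℚᵘ-/ x)) (≃-trans (ℚₚ.toℚᵘ-cong e) (toℚᵘ-/ y))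
  ... | ℚᵘ.*≡* eq = ℤₚ.*-cancelʳ-≡ x y (+ suc k) eq

  toℚ≡scaled : ∀ x → toℚ x ≡ (x * + suc k) ℚ./ suc k
  toℚ≡scaled x = ℚₚ.toℚᵘ-injective (≃-trans (toℚᵘ-toℚ x)
    (≃-trans (ℚᵘ.*≡* {ℚᵘ.mkℚᵘ x 0} {ℚᵘ.mkℚᵘ (x * + suc k) k} (sym (ℤₚ.*-identityʳ (x * + suc k)))) (≃-sym (toℚᵘ-/ (x * + suc k)))))

  integralCoset⇒sameCoset : ∀ {X Y M N} → X ≐ scaled M → Y ≐ scaled N → IntegralCoset M N → SameCoset X Y
  integralCoset⇒sameCoset {M = M} X≐M Y≐N (γ , det≡1 , γM≐N) = γ , det≡1 , λ i j →
    trans (·-congʳ γ X≐M i j) (trans (·-scaled γ M i j) (trans (cong (ℚ._/ suc k) (γM≐N i j)) (sym (Y≐N i j))))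

  sameCoset⇒integralCoset : ∀ {X Y M N} → X ≐ scaled M → Y ≐ scaled N → SameCoset X Y → IntegralCoset M N
  sameCoset⇒integralCoset {M = M} X≐M Y≐N (γ , det≡1 , γX≐Y) = γ , det≡1 , λ i j →
    /-injective _ _ (trans (sym (·-scaled γ M i j)) (trans (sym (·-congʳ γ X≐M i j)) (trans (γX≐Y i j) (Y≐N i j))))

-- q · imageMat and q · nD, in the variables A = a, A′ = q/a, Q = q = A A′.
upperForm : (A A′ B S₁ S₂ Q : ℤ) → Mat ℤ
upperForm A A′ B S₁ S₂ Q = mat3 (A * Q) (B * Q) S₁ (+ 0 * Q) (A′ * Q) S₂ (+ 0 * Q) (+ 0 * Q) (+ 1 * Q)

lowerForm : (P₁ P₂ Q : ℤ) → Mat ℤ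
lowerForm P₁ P₂ Q = mat3 (Q * Q) (+ 0 * Q) (+ 0 * Q) (+ 0 * Q) (Q * Q) (+ 0 * Q) (P₁ * Q) (P₂ * Q) (+ 1)

-- The data of  γ = (A′ −B x; 0 A −I₂; G₀ G₁ G₂),  which carries the upper form with
-- S₂ = A′ I₂ to the lower form.
record Lift (A A′ B I₂ S₁ P₁ P₂ : ℤ) : Set where
  field
    x G₀ G₁ G₂ : ℤ
    A*x≡ : A * x ≡ B * I₂ - S₁
    last-row-unimodular : G₀ * S₁ + G₁ * (A′ * I₂) + G₂ * (A * A′) ≡ + 1
    G₀*A≡P₁ : G₀ * A ≡ P₁
    G₀*B+G₁*A′≡P₂ : G₀ * B + G₁ * A′ ≡ P₂

liftMat : (A A′ B I₂ x G₀ G₁ G₂ : ℤ) → Mat ℤ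
liftMat A A′ B I₂ x G₀ G₁ G₂ = mat3 A′ (- B) x (+ 0) A (- I₂) G₀ G₁ G₂

module _ {A A′ B I₂ S₁ P₁ P₂ : ℤ} (L : Lift A A′ B I₂ S₁ P₁ P₂) where
  open Lift L

  private
    Q : ℤ
    Q = A * A′
    γ : Mat ℤ
    γ = liftMat A A′ B I₂ x G₀ G₁ G₂

  lift-det : InΓ γ
  lift-det = drop-vanishing₂ (- G₀) (+ 1) (expand A A′ B I₂ S₁ x G₀ G₁ G₂) A*x≡ last-row-unimodular
    where
    expand : ∀ A A′ B I₂ S₁ x G₀ G₁ G₂ →
      A′ * (A * G₂ - (- I₂) * G₁) - (- B) * (+ 0 * G₂ - (- I₂) * G₀) + x * (+ 0 * G₁ - A * G₀)
      ≡ + 1 + (- G₀) * (A * x - (B * I₂ - S₁)) + (+ 1) * ((G₀ * S₁ + G₁ * (A′ * I₂) + G₂ * (A * A′)) - + 1)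
    expand = solve-∀

  lift-maps : γ ⊗ upperForm A A′ B S₁ (A′ * I₂) Q ≐ lowerForm P₁ P₂ Q
  lift-maps zero zero = expand A A′ B x
    where
    expand : ∀ A A′ B x → A′ * (A * (A * A′)) + (- B) * (+ 0 * (A * A′)) + x * (+ 0 * (A * A′)) ≡ (A * A′) * (A * A′)
    expand = solve-∀
  lift-maps zero (suc zero) = expand A A′ B x
    where
    expand : ∀ A A′ B x → A′ * (B * (A * A′)) + (- B) * (A′ * (A * A′)) + x * (+ 0 * (A * A′)) ≡ + 0 * (A * A′)
    expand = solve-∀
  lift-maps zero (suc (suc zero)) = drop-vanishing A′ (expand A A′ B I₂ S₁ x) A*x≡
    where
    expand : ∀ A A′ B I₂ S₁ x → A′ * S₁ + (- B) * (A′ * I₂) + x * (+ 1 * (A * A′)) ≡ + 0 * (A * A′) + A′ * (A * x - (B * I₂ - S₁))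
    expand = solve-∀
  lift-maps (suc zero) zero = expand A A′ I₂
    where
    expand : ∀ A A′ I₂ → + 0 * (A * (A * A′)) + A * (+ 0 * (A * A′)) + (- I₂) * (+ 0 * (A * A′)) ≡ + 0 * (A * A′)
    expand = solve-∀
  lift-maps (suc zero) (suc zero) = expand A A′ B I₂
    where
    expand : ∀ A A′ B I₂ → + 0 * (B * (A * A′)) + A * (A′ * (A * A′)) + (- I₂) * (+ 0 * (A * A′)) ≡ (A * A′) * (A * A′)
    expand = solve-∀
  lift-maps (suc zero) (suc (suc zero)) = expand A A′ I₂ S₁
    where
    expand : ∀ A A′ I₂ S₁ → + 0 * S₁ + A * (A′ * I₂) + (- I₂) * (+ 1 * (A * A′)) ≡ + 0 * (A * A′)
    expand = solve-∀
  lift-maps (suc (suc zero)) zero = drop-vanishing (A * A′) (expand A A′ G₀ G₁ G₂ P₁) G₀*A≡P₁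
    where
    expand : ∀ A A′ G₀ G₁ G₂ P₁ → G₀ * (A * (A * A′)) + G₁ * (+ 0 * (A * A′)) + G₂ * (+ 0 * (A * A′))
      ≡ P₁ * (A * A′) + (A * A′) * (G₀ * A - P₁)
    expand = solve-∀
  lift-maps (suc (suc zero)) (suc zero) = drop-vanishing (A * A′) (expand A A′ B G₀ G₁ G₂ P₂) G₀*B+G₁*A′≡P₂
    where
    expand : ∀ A A′ B G₀ G₁ G₂ P₂ → G₀ * (B * (A * A′)) + G₁ * (A′ * (A * A′)) + G₂ * (+ 0 * (A * A′))
      ≡ P₂ * (A * A′) + (A * A′) * (G₀ * B + G₁ * A′ - P₂)
    expand = solve-∀
  lift-maps (suc (suc zero)) (suc (suc zero)) = drop-vanishing (+ 1) (expand A A′ I₂ S₁ G₀ G₁ G₂) last-row-unimodular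
    where
    expand : ∀ A A′ I₂ S₁ G₀ G₁ G₂ → G₀ * S₁ + G₁ * (A′ * I₂) + G₂ * (+ 1 * (A * A′))
      ≡ + 1 + (+ 1) * (G₀ * S₁ + G₁ * (A′ * I₂) + G₂ * (A * A′) - + 1)
    expand = solve-∀

  lift⇒integralCoset : IntegralCoset (upperForm A A′ B S₁ (A′ * I₂) Q) (lowerForm P₁ P₂ Q)
  lift⇒integralCoset = γ , lift-det , lift-maps

  -- Each of A, B, A′ is an integral combination of P₁, P₂ and Q.
  lift-common-divisor : ∀ {d} → d ∣ᶻ P₁ → d ∣ᶻ P₂ → d ∣ᶻ Q → d ∣ᶻ A × d ∣ᶻ B × d ∣ᶻ A′
  lift-common-divisor d∣P₁ d∣P₂ d∣Q =
    ∣-resp-≡ (sym (drop-vanishing₂ (- A) S₁ (A-comb A A′ I₂ S₁ G₀ G₁ G₂ P₁) last-row-unimodular G₀*A≡P₁))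
      (∣-lincomb S₁ (G₁ * I₂ + A * G₂) d∣P₁ d∣Q) ,
    ∣-resp-≡ (sym (drop-vanishing₃ (- B) S₁ (- (G₁ * A′)) (B-comb A A′ B I₂ S₁ x G₀ G₁ G₂ P₂)
                                   last-row-unimodular G₀*B+G₁*A′≡P₂ A*x≡))
      (∣-lincomb S₁ (G₁ * x + B * G₂) d∣P₂ d∣Q) ,
    ∣-resp-≡ (sym (drop-vanishing₃ (- A′) (A′ * I₂) (A′ * G₀) (A′-comb A A′ B I₂ S₁ x G₀ G₁ G₂ P₂)
                                   last-row-unimodular G₀*B+G₁*A′≡P₂ A*x≡))
      (∣-lincomb (A′ * I₂) (A′ * G₂ - G₀ * x) d∣P₂ d∣Q)
    where
    A-comb : ∀ A A′ I₂ S₁ G₀ G₁ G₂ P₁ → A ≡ S₁ * P₁ + (G₁ * I₂ + A * G₂) * (A * A′)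
      + (- A) * (G₀ * S₁ + G₁ * (A′ * I₂) + G₂ * (A * A′) - + 1) + S₁ * (G₀ * A - P₁)
    A-comb = solve-∀
    B-comb : ∀ A A′ B I₂ S₁ x G₀ G₁ G₂ P₂ → B ≡ S₁ * P₂ + (G₁ * x + B * G₂) * (A * A′)
      + (- B) * (G₀ * S₁ + G₁ * (A′ * I₂) + G₂ * (A * A′) - + 1) + S₁ * (G₀ * B + G₁ * A′ - P₂)
      + (- (G₁ * A′)) * (A * x - (B * I₂ - S₁))
    B-comb = solve-∀
    A′-comb : ∀ A A′ B I₂ S₁ x G₀ G₁ G₂ P₂ → A′ ≡ (A′ * I₂) * P₂ + (A′ * G₂ - G₀ * x) * (A * A′)
      + (- A′) * (G₀ * S₁ + G₁ * (A′ * I₂) + G₂ * (A * A′) - + 1) + (A′ * I₂) * (G₀ * B + G₁ * A′ - P₂)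
      + (A′ * G₀) * (A * x - (B * I₂ - S₁))
    A′-comb = solve-∀

lift-reduce : ∀ {A A′ B I₂ S₁ P₁ P₂ p₁ p₂} d₁ d₂ → Lift A A′ B I₂ S₁ P₁ P₂
  → P₁ - p₁ ≡ d₁ * (A * A′) → P₂ - p₂ ≡ d₂ * (A * A′) → Lift A A′ B I₂ S₁ p₁ p₂
lift-reduce {A} {A′} {B} {I₂} {S₁} {P₁} {P₂} {p₁} {p₂} d₁ d₂ L P₁≡ P₂≡ = record
  { x = x
  ; G₀ = G₀ - d₁ * A′
  ; G₁ = G₁ + d₁ * B - d₂ * A
  ; G₂ = G₂ - d₁ * x + d₂ * I₂
  ; A*x≡ = A*x≡
  ; last-row-unimodular = drop-vanishing₂ (+ 1) (- (d₁ * A′)) (expand₀ G₀ G₁ G₂ d₁ d₂ x S₁ A A′ B I₂) last-row-unimodular A*x≡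
  ; G₀*A≡P₁ = drop-vanishing₂ (+ 1) (+ 1) (expand₁ G₀ d₁ A A′ P₁ p₁) G₀*A≡P₁ P₁≡
  ; G₀*B+G₁*A′≡P₂ = drop-vanishing₂ (+ 1) (+ 1) (expand₂ G₀ G₁ d₁ d₂ A A′ B P₂ p₂) G₀*B+G₁*A′≡P₂ P₂≡
  }
  where
  open Lift L
  expand₀ : ∀ G₀ G₁ G₂ d₁ d₂ x S₁ A A′ B I₂ →
    (G₀ - d₁ * A′) * S₁ + (G₁ + d₁ * B - d₂ * A) * (A′ * I₂) + (G₂ - d₁ * x + d₂ * I₂) * (A * A′)
    ≡ + 1 + (+ 1) * (G₀ * S₁ + G₁ * (A′ * I₂) + G₂ * (A * A′) - + 1) + (- (d₁ * A′)) * (A * x - (B * I₂ - S₁))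
  expand₀ = solve-∀
  expand₁ : ∀ G₀ d₁ A A′ P₁ p₁ → (G₀ - d₁ * A′) * A ≡ p₁ + (+ 1) * (G₀ * A - P₁) + (+ 1) * (P₁ - p₁ - d₁ * (A * A′))
  expand₁ = solve-∀
  expand₂ : ∀ G₀ G₁ d₁ d₂ A A′ B P₂ p₂ → (G₀ - d₁ * A′) * B + (G₁ + d₁ * B - d₂ * A) * A′
    ≡ p₂ + (+ 1) * (G₀ * B + G₁ * A′ - P₂) + (+ 1) * (P₂ - p₂ - d₂ * (A * A′))
  expand₂ = solve-∀

-- A fixed divisor a of q

module PerDivisor
  (a a′ Q₀ Q₁ : ℕ) .{{_ : NonZero (a ℕ.* a′)}} (L₀ L₁ : ℤ) (inv₁ inv₂ : ℕ → ℤ)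
  (q₀*q₁≡a*a′ : Q₀ ℕ.* Q₁ ≡ a ℕ.* a′)
  (q₀⊥q₁ : Coprime Q₀ Q₁)
  (a∣q₀ : a ∣ Q₀)
  (divisor-of-q₀-coprime-to-a : ∀ d → d ∣ Q₀ → Coprime d a → d ≡ 1)
  (bézout-q₀-q₁ : + Q₀ * L₀ + + Q₁ * L₁ ≡ + 1)
  (inv₁-spec : ∀ c → gcd c Q₁ ≡ 1 → + Q₁ ∣ᶻ + c * inv₁ c - + 1)
  (inv₂-spec : ∀ c → gcd c Q₀ ≡ 1 → + Q₀ ∣ᶻ + c * inv₂ c - + 1)
  where

  private
    A A′ : ℤ
    A = + a
    A′ = + a′

    A*A′≡Q₀*Q₁ : A * A′ ≡ + Q₀ * + Q₁
    A*A′≡Q₀*Q₁ = trans (sym (ℤₚ.pos-* a a′)) (trans (cong +_ (sym q₀*q₁≡a*a′)) (ℤₚ.pos-* Q₀ Q₁))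

    Q₁∣a′ : Q₁ ∣ a′
    Q₁∣a′ = ℕC.coprime-divisor (λ (i∣Q₁ , i∣a) → q₀⊥q₁ (ℕD.∣-trans i∣a a∣q₀ , i∣Q₁))
                               (subst (Q₁ ∣_) q₀*q₁≡a*a′ (ℕD.n∣m*n Q₀))

  -- q times the first entry of the vector s of the statement.
  S₁ : ℕ → ℕ → ℕ → ℤ
  S₁ c₁ c₂ b = inv₁ c₁ * + Q₀ * L₀ + + b * inv₂ c₂ * + Q₁ * L₁

  Admissible : ℕ → ℕ → ℕ → Set
  Admissible c₁ c₂ b = (1 ≤ c₁ × c₁ ≤ Q₁) × (1 ≤ c₂ × c₂ ≤ Q₀) × (1 ≤ b × b ≤ a′)
    × gcd c₁ Q₁ ≡ 1 × gcd c₂ Q₀ ≡ 1 × gcd b (gcd a′ a) ≡ 1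

  S₁≡inv₁-mod-q₁ : ∀ c₁ c₂ b → + Q₁ ∣ᶻ S₁ c₁ c₂ b - inv₁ c₁
  S₁≡inv₁-mod-q₁ c₁ c₂ b =
    ∣-resp-≡ (sym (drop-vanishing (inv₁ c₁) (identity (inv₁ c₁) (+ Q₀) L₀ (+ b) (inv₂ c₂) (+ Q₁) L₁) bézout-q₀-q₁))
    (ℤ∣.∣n⇒∣m*n ((+ b * inv₂ c₂ - inv₁ c₁) * L₁) ℤ∣.∣-refl)
    where
    identity : ∀ I₁ Q₀ L₀ B I₂ Q₁ L₁ → I₁ * Q₀ * L₀ + B * I₂ * Q₁ * L₁ - I₁
      ≡ ((B * I₂ - I₁) * L₁) * Q₁ + I₁ * (Q₀ * L₀ + Q₁ * L₁ - + 1)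
    identity = solve-∀

  S₁≡b*inv₂-mod-q₀ : ∀ c₁ c₂ b → + Q₀ ∣ᶻ S₁ c₁ c₂ b - + b * inv₂ c₂
  S₁≡b*inv₂-mod-q₀ c₁ c₂ b =
    ∣-resp-≡ (sym (drop-vanishing (+ b * inv₂ c₂) (identity (inv₁ c₁) (+ Q₀) L₀ (+ b) (inv₂ c₂) (+ Q₁) L₁) bézout-q₀-q₁))
    (ℤ∣.∣n⇒∣m*n ((inv₁ c₁ - + b * inv₂ c₂) * L₀) ℤ∣.∣-refl)
    where
    identity : ∀ I₁ Q₀ L₀ B I₂ Q₁ L₁ → I₁ * Q₀ * L₀ + B * I₂ * Q₁ * L₁ - B * I₂
      ≡ ((I₁ - B * I₂) * L₀) * Q₀ + (B * I₂) * (Q₀ * L₀ + Q₁ * L₁ - + 1)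
    identity = solve-∀

  -- Because a ∣ q₀ and S₁ ≡ b c̄₂ (mod q₀).
  a∣b*inv₂-S₁ : ∀ c₁ c₂ b → Σ ℤ λ x → A * x ≡ + b * inv₂ c₂ - S₁ c₁ c₂ b
  a∣b*inv₂-S₁ c₁ c₂ b = divide a∣q₀
    where
    identity : ∀ e A L₀ B I₂ I₁ Q₀ Q₁ L₁ → A * (e * L₀ * (B * I₂ - I₁))
      ≡ B * I₂ - (I₁ * Q₀ * L₀ + B * I₂ * Q₁ * L₁) + B * I₂ * (Q₀ * L₀ + Q₁ * L₁ - + 1) + L₀ * (B * I₂ - I₁) * (e * A - Q₀)
    identity = solve-∀
    divide : a ∣ Q₀ → Σ ℤ λ x → A * x ≡ + b * inv₂ c₂ - S₁ c₁ c₂ b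
    divide (ℕD.divides e Q₀≡e*a) = + e * L₀ * (+ b * inv₂ c₂ - inv₁ c₁) ,
      drop-vanishing₂ (+ b * inv₂ c₂) (L₀ * (+ b * inv₂ c₂ - inv₁ c₁))
        (identity (+ e) A L₀ (+ b) (inv₂ c₂) (inv₁ c₁) (+ Q₀) (+ Q₁) L₁) bézout-q₀-q₁
        (sym (trans (cong +_ Q₀≡e*a) (ℤₚ.pos-* e a)))

  coprime-q₀-b-a′ : ∀ {b} → gcd b (gcd a′ a) ≡ 1 → Coprimeℤ₃ (+ Q₀) (+ b) A′
  coprime-q₀-b-a′ gb g∣Q₀ g∣b g∣a′ = ∣∣≡1⇒∣1 (divisor-of-q₀-coprime-to-a _ (ℤ∣.∣⇒∣ᵤ g∣Q₀)
    λ {i} (i∣g , i∣a) → ∣1⇒∣∣≡1 (gcd≡1⇒coprimeℤ gb {+ i}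
      (ℤ∣.∣ᵤ⇒∣ (ℕD.∣-trans i∣g (ℤ∣.∣⇒∣ᵤ g∣b)))
      (ℤ∣.∣ᵤ⇒∣ (ℕG.gcd-greatest (ℕD.∣-trans i∣g (ℤ∣.∣⇒∣ᵤ g∣a′)) i∣a))))

  coprime-S₁-S₂-Q : ∀ {c₁ c₂ b} → gcd c₁ Q₁ ≡ 1 → gcd c₂ Q₀ ≡ 1 → gcd b (gcd a′ a) ≡ 1
    → Coprimeℤ₃ (S₁ c₁ c₂ b) (A′ * inv₂ c₂) (A * A′)
  coprime-S₁-S₂-Q {c₁} {c₂} {b} gc₁ gc₂ gb {d} d∣S₁ d∣S₂ d∣Q = d⊥Q₁ ℤ∣.∣-refl d∣Q₁
    where
    d⊥Q₁ : Coprimeℤ d (+ Q₁)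
    d⊥Q₁ g∣d g∣Q₁ = ∣-unit-cancel {c = + c₁} g∣Q₁ (inv₁-spec c₁ gc₁)
      (∣-resp-≡ (sym (ℤₚ.*-identityˡ (inv₁ c₁))) (∣-congruentˡ (S₁≡inv₁-mod-q₁ c₁ c₂ b) g∣Q₁ (ℤ∣.∣-trans g∣d d∣S₁)))
    d⊥Q₀ : Coprimeℤ d (+ Q₀)
    d⊥Q₀ g∣d g∣Q₀ = coprime-q₀-b-a′ {b} gb g∣Q₀
      (∣-unit-cancel {c = + c₂} g∣Q₀ (inv₂-spec c₂ gc₂) (∣-congruentˡ (S₁≡b*inv₂-mod-q₀ c₁ c₂ b) g∣Q₀ (ℤ∣.∣-trans g∣d d∣S₁)))
      (∣-unit-cancel {c = + c₂} g∣Q₀ (inv₂-spec c₂ gc₂) (ℤ∣.∣-trans g∣d d∣S₂))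
    d∣Q₁ : d ∣ᶻ + Q₁
    d∣Q₁ = coprimeℤ-divisor d⊥Q₀ (∣-resp-≡ A*A′≡Q₀*Q₁ d∣Q)

  lift⇒coprime-point : ∀ {b I₂ S p₁ p₂} → gcd b (gcd a′ a) ≡ 1 → Lift A A′ (+ b) I₂ S (+ p₁) (+ p₂)
    → gcd (gcd p₁ p₂) (a ℕ.* a′) ≡ 1
  lift⇒coprime-point {b} {p₁ = p₁} {p₂} gb L =
    let g∣A , g∣b , g∣A′ = lift-common-divisor L (ℤ∣.∣ᵤ⇒∣ (ℕD.∣-trans g∣gcd[p₁,p₂] (ℕG.gcd[m,n]∣m p₁ p₂)))
                                                 (ℤ∣.∣ᵤ⇒∣ (ℕD.∣-trans g∣gcd[p₁,p₂] (ℕG.gcd[m,n]∣n p₁ p₂)))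
                                                 (∣-resp-≡ (ℤₚ.pos-* a a′) (ℤ∣.∣ᵤ⇒∣ (ℕG.gcd[m,n]∣n (gcd p₁ p₂) (a ℕ.* a′))))
    in ∣1⇒∣∣≡1 (gcd≡1⇒coprimeℤ gb {+ g} g∣b (ℤ∣.∣ᵤ⇒∣ (ℕG.gcd-greatest (ℤ∣.∣⇒∣ᵤ g∣A′) (ℤ∣.∣⇒∣ᵤ g∣A))))
    where
    g : ℕ
    g = gcd (gcd p₁ p₂) (a ℕ.* a′)
    g∣gcd[p₁,p₂] : g ∣ gcd p₁ p₂
    g∣gcd[p₁,p₂] = ℕG.gcd[m,n]∣m (gcd p₁ p₂) (a ℕ.* a′)

  tuple⇒lift : ∀ {c₁ c₂ b} → Admissible c₁ c₂ b
    → Σ ℕ λ p₁ → Σ ℕ λ p₂ → InR (a ℕ.* a′) p₁ p₂ × Lift A A′ (+ b) (inv₂ c₂) (S₁ c₁ c₂ b) (+ p₁) (+ p₂)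
  tuple⇒lift {c₁} {c₂} {b} (_ , _ , _ , gc₁ , gc₂ , gb) =
    reduce (coprimeℤ₃⇒bézout (S₁ c₁ c₂ b) (A′ * inv₂ c₂) (A * A′) (coprime-S₁-S₂-Q {c₁} {c₂} {b} gc₁ gc₂ gb))
    where
    reduce : (Σ ℤ λ u → Σ ℤ λ v → Σ ℤ λ w → u * S₁ c₁ c₂ b + v * (A′ * inv₂ c₂) + w * (A * A′) ≡ + 1)
      → Σ ℕ λ p₁ → Σ ℕ λ p₂ → InR (a ℕ.* a′) p₁ p₂ × Lift A A′ (+ b) (inv₂ c₂) (S₁ c₁ c₂ b) (+ p₁) (+ p₂)
    reduce (u , v , w , uvw) = reduce-mod-q (representative P₁ (a ℕ.* a′)) (representative P₂ (a ℕ.* a′))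
      where
      P₁ P₂ : ℤ
      P₁ = u * A
      P₂ = u * + b + v * A′
      bézout-lift : Lift A A′ (+ b) (inv₂ c₂) (S₁ c₁ c₂ b) P₁ P₂
      bézout-lift = record
        { x = proj₁ (a∣b*inv₂-S₁ c₁ c₂ b) ; G₀ = u ; G₁ = v ; G₂ = w ; A*x≡ = proj₂ (a∣b*inv₂-S₁ c₁ c₂ b)
        ; last-row-unimodular = uvw ; G₀*A≡P₁ = refl ; G₀*B+G₁*A′≡P₂ = refl }
      reduce-mod-q : Representative P₁ (a ℕ.* a′) → Representative P₂ (a ℕ.* a′)
        → Σ ℕ λ p₁ → Σ ℕ λ p₂ → InR (a ℕ.* a′) p₁ p₂ × Lift A A′ (+ b) (inv₂ c₂) (S₁ c₁ c₂ b) (+ p₁) (+ p₂)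
      reduce-mod-q (p₁ , p₁-range , d₁ , P₁≡) (p₂ , p₂-range , d₂ , P₂≡) =
        p₁ , p₂ , (p₁-range , p₂-range , lift⇒coprime-point gb L) , L
        where
        L : Lift A A′ (+ b) (inv₂ c₂) (S₁ c₁ c₂ b) (+ p₁) (+ p₂)
        L = lift-reduce d₁ d₂ bézout-lift (trans P₁≡ (cong (d₁ *_) (ℤₚ.pos-* a a′))) (trans P₂≡ (cong (d₂ *_) (ℤₚ.pos-* a a′)))

  private
    instance
      Q₀*Q₁≢0 : NonZero (Q₀ ℕ.* Q₁)
      Q₀*Q₁≢0 = subst NonZero (sym q₀*q₁≡a*a′) (ℕₚ.m*n≢0 a a′ {{ℕₚ.m*n≢0⇒m≢0 a}} {{ℕₚ.m*n≢0⇒n≢0 a}})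
      Q₀≢0 : NonZero Q₀
      Q₀≢0 = ℕₚ.m*n≢0⇒m≢0 Q₀
      Q₁≢0 : NonZero Q₁
      Q₁≢0 = ℕₚ.m*n≢0⇒n≢0 Q₀
      a′≢0 : NonZero a′
      a′≢0 = ℕₚ.m*n≢0⇒n≢0 a

    -- The preimage of q⁻¹(p₁, p₂): the last row of γ is (p₁′, p₂ β + p₁′ k, G₂), where
    -- G₂ exists by the Chinese remainder theorem for q = q₀ q₁.
    module Preimage {p₁ p₂ p₁′ : ℕ} (p₁≡p₁′*a : p₁ ≡ p₁′ ℕ.* a)
      (gcd[p₁,p₂,q]≡1 : gcd (gcd p₁ p₂) (a ℕ.* a′) ≡ 1)
      (α β : ℤ) (αβ : α * + p₁′ + β * A′ ≡ + 1)
      (b : ℕ) (k : ℤ) (b≡ : + p₂ * α - + b ≡ k * A′)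
      (c₁ : ℕ) (k₁ : ℤ) (c₁≡ : + p₁′ - + c₁ ≡ k₁ * + Q₁)
      (c₂ : ℕ) (k₂ : ℤ) (c₂≡ : + p₂ - + c₂ ≡ k₂ * + Q₀) where

      G₀ G₁ : ℤ
      G₀ = + p₁′
      G₁ = + p₂ * β + + p₁′ * k

      c₁⊥Q₁ : gcd c₁ Q₁ ≡ 1
      c₁⊥Q₁ = coprimeℤ⇒gcd≡1 {c₁} {Q₁} λ g∣c₁ g∣Q₁ → bézout⇒coprimeℤ {α} {+ p₁′} {β} {A′} αβ
        (∣-congruentʳ (divides k₁ c₁≡) g∣Q₁ g∣c₁) (ℤ∣.∣-trans g∣Q₁ (ℤ∣.∣ᵤ⇒∣ Q₁∣a′))

      p₂⊥Q₀ : Coprimeℤ (+ p₂) (+ Q₀)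
      p₂⊥Q₀ {g} g∣p₂ g∣Q₀ = ∣∣≡1⇒∣1 {g} (divisor-of-q₀-coprime-to-a ∣ g ∣ (ℤ∣.∣⇒∣ᵤ g∣Q₀)
        λ {i} (i∣g , i∣a) → ∣1⇒∣∣≡1 (gcd≡1⇒coprimeℤ₃ gcd[p₁,p₂,q]≡1 {+ i}
          (ℤ∣.∣ᵤ⇒∣ (ℕD.∣-trans i∣a (ℕD.divides p₁′ p₁≡p₁′*a)))
          (ℤ∣.∣-trans (ℤ∣.∣ᵤ⇒∣ {+ i} {g} i∣g) g∣p₂)
          (ℤ∣.∣ᵤ⇒∣ (ℕD.∣-trans i∣a (ℕD.m∣m*n a′)))))

      c₂⊥Q₀ : gcd c₂ Q₀ ≡ 1
      c₂⊥Q₀ = coprimeℤ⇒gcd≡1 {c₂} {Q₀} λ g∣c₂ g∣Q₀ → p₂⊥Q₀ (∣-congruentʳ (divides k₂ c₂≡) g∣Q₀ g∣c₂) g∣Q₀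

      G₀*A≡p₁ : G₀ * A ≡ + p₁
      G₀*A≡p₁ = sym (trans (cong +_ p₁≡p₁′*a) (ℤₚ.pos-* p₁′ a))

      G₀*b+G₁*A′≡p₂ : G₀ * + b + G₁ * A′ ≡ + p₂
      G₀*b+G₁*A′≡p₂ = drop-vanishing₂ (- G₀) (+ p₂) (identity G₀ (+ b) (+ p₂) β k A′ α) b≡ αβ
        where
        identity : ∀ P₁′ B P₂ β k A′ α → P₁′ * B + (P₂ * β + P₁′ * k) * A′
          ≡ P₂ + (- P₁′) * (P₂ * α - B - k * A′) + P₂ * (α * P₁′ + β * A′ - + 1)
        identity = solve-∀

      b⊥gcd[a′,a] : gcd b (gcd a′ a) ≡ 1
      b⊥gcd[a′,a] = coprimeℤ⇒gcd≡1 {b} {gcd a′ a} λ g∣b g∣gcd → gcd≡1⇒coprimeℤ₃ gcd[p₁,p₂,q]≡1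
        (∣-resp-≡ G₀*A≡p₁ (ℤ∣.∣n⇒∣m*n G₀ (g∣A g∣gcd)))
        (∣-resp-≡ G₀*b+G₁*A′≡p₂ (∣-lincomb G₀ G₁ g∣b (g∣A′ g∣gcd)))
        (∣-resp-≡ (sym (ℤₚ.pos-* a a′)) (ℤ∣.∣n⇒∣m*n A (g∣A′ g∣gcd)))
        where
        g∣A′ : ∀ {g} → g ∣ᶻ + gcd a′ a → g ∣ᶻ A′
        g∣A′ g∣gcd = ℤ∣.∣-trans g∣gcd (ℤ∣.∣ᵤ⇒∣ (ℕG.gcd[m,n]∣m a′ a))
        g∣A : ∀ {g} → g ∣ᶻ + gcd a′ a → g ∣ᶻ A
        g∣A g∣gcd = ℤ∣.∣-trans g∣gcd (ℤ∣.∣ᵤ⇒∣ (ℕG.gcd[m,n]∣n a′ a))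

      I₁ I₂ S Z : ℤ
      I₁ = inv₁ c₁
      I₂ = inv₂ c₂
      S = S₁ c₁ c₂ b
      Z = G₀ * S + G₁ * (A′ * I₂) - + 1

      Q₁∣Z : + Q₁ ∣ᶻ Z
      Q₁∣Z = ∣-resp-≡ (identity (+ c₁) I₁ I₂ G₀ G₁ S A′)
        (ℤ∣.∣m∣n⇒∣m+n (∣-lincomb₃ (+ 1) G₀ I₁ (inv₁-spec c₁ c₁⊥Q₁) (S₁≡inv₁-mod-q₁ c₁ c₂ b) (divides k₁ c₁≡))
                      (ℤ∣.∣n⇒∣m*n (G₁ * I₂) (ℤ∣.∣ᵤ⇒∣ Q₁∣a′)))
        where
        identity : ∀ c I₁ I₂ G₀ G₁ S A′ → (+ 1) * (c * I₁ - + 1) + G₀ * (S - I₁) + I₁ * (G₀ - c) + G₁ * I₂ * A′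
          ≡ G₀ * S + G₁ * (A′ * I₂) - + 1
        identity = solve-∀

      Q₀∣Z : + Q₀ ∣ᶻ Z
      Q₀∣Z = ∣-resp-≡ (drop-vanishing (- I₂) (identity (+ c₂) I₂ G₀ G₁ S (+ b) A′ (+ p₂)) G₀*b+G₁*A′≡p₂)
        (∣-lincomb₃ (+ 1) G₀ I₂ (inv₂-spec c₂ c₂⊥Q₀) (S₁≡b*inv₂-mod-q₀ c₁ c₂ b) (divides k₂ c₂≡))
        where
        identity : ∀ c I₂ G₀ G₁ S B A′ P₂ → (+ 1) * (c * I₂ - + 1) + G₀ * (S - B * I₂) + I₂ * (P₂ - c)
          ≡ G₀ * S + G₁ * (A′ * I₂) - + 1 + (- I₂) * (G₀ * B + G₁ * A′ - P₂)
        identity = solve-∀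

      lift : Lift A A′ (+ b) I₂ S (+ p₁) (+ p₂)
      lift = complete (coprimeℤ-∣⇒*-∣ (gcd≡1⇒coprimeℤ (ℕC.coprime⇒gcd≡1 q₀⊥q₁)) Q₁∣Z Q₀∣Z)
        where
        identity : ∀ Z m AA′ Q₀Q₁ → Z + (- m) * AA′ ≡ + 1 + (+ 1) * (Z - + 1 - m * Q₀Q₁) + (- m) * (AA′ - Q₀Q₁)
        identity = solve-∀
        complete : + Q₀ * + Q₁ ∣ᶻ Z → Lift A A′ (+ b) I₂ S (+ p₁) (+ p₂)
        complete (divides m Z≡) = record
          { x = proj₁ (a∣b*inv₂-S₁ c₁ c₂ b) ; G₀ = G₀ ; G₁ = G₁ ; G₂ = - m
          ; A*x≡ = proj₂ (a∣b*inv₂-S₁ c₁ c₂ b)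
          ; last-row-unimodular = drop-vanishing₂ (+ 1) (- m)
              (identity (G₀ * S + G₁ * (A′ * I₂)) m (A * A′) (+ Q₀ * + Q₁)) Z≡ A*A′≡Q₀*Q₁
          ; G₀*A≡P₁ = G₀*A≡p₁ ; G₀*B+G₁*A′≡P₂ = G₀*b+G₁*A′≡p₂ }

  point⇒tuple : ∀ {p₁ p₂ p₁′} → p₁ ≡ p₁′ ℕ.* a → Coprime p₁′ a′ → gcd (gcd p₁ p₂) (a ℕ.* a′) ≡ 1
    → Σ ℕ λ c₁ → Σ ℕ λ c₂ → Σ ℕ λ b → Admissible c₁ c₂ b × Lift A A′ (+ b) (inv₂ c₂) (S₁ c₁ c₂ b) (+ p₁) (+ p₂)
  point⇒tuple {p₁} {p₂} {p₁′} p₁≡p₁′*a p₁′⊥a′ gcd[p₁,p₂,q]≡1 =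
    choose (coprimeℤ⇒bézout (+ p₁′) A′ (gcd≡1⇒coprimeℤ (ℕC.coprime⇒gcd≡1 p₁′⊥a′)))
    where
    choose : (Σ ℤ λ α → Σ ℤ λ β → α * + p₁′ + β * A′ ≡ + 1)
      → Σ ℕ λ c₁ → Σ ℕ λ c₂ → Σ ℕ λ b → Admissible c₁ c₂ b × Lift A A′ (+ b) (inv₂ c₂) (S₁ c₁ c₂ b) (+ p₁) (+ p₂)
    choose (α , β , αβ) with representative (+ p₂ * α) a′ | representative (+ p₁′) Q₁ | representative (+ p₂) Q₀
    ... | b , b-range , k , b≡ | c₁ , c₁-range , k₁ , c₁≡ | c₂ , c₂-range , k₂ , c₂≡ =
      c₁ , c₂ , b , (c₁-range , c₂-range , b-range , c₁⊥Q₁ , c₂⊥Q₀ , b⊥gcd[a′,a]) , lift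
      where open Preimage p₁≡p₁′*a gcd[p₁,p₂,q]≡1 α β αβ b k b≡ c₁ k₁ c₁≡ c₂ k₂ c₂≡

  congruent-numerators⇒c≡ : ∀ {c₁ c₂ C₁ C₂ b} g₁₂ g₀₂ → Admissible c₁ c₂ b → Admissible C₁ C₂ b
    → A′ * inv₂ C₂ ≡ A′ * inv₂ c₂ + g₁₂ * (A * A′) → S₁ C₁ C₂ b ≡ S₁ c₁ c₂ b + g₀₂ * (A * A′)
    → c₁ ≡ C₁ × c₂ ≡ C₂
  congruent-numerators⇒c≡ {c₁} {c₂} {C₁} {C₂} {b} g₁₂ g₀₂ (c₁-range , c₂-range , _ , gc₁ , gc₂ , gb)
                    (C₁-range , C₂-range , _ , gC₁ , gC₂ , _) A′J₂≡ S≡ =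
    congruent-in-range⇒≡ (proj₁ c₁-range) (proj₂ c₁-range) (proj₁ C₁-range) (proj₂ C₁-range)
      (inverses-congruent (+ c₁) (+ C₁) (inv₁ c₁) (inv₁ C₁) (inv₁-spec C₁ gC₁) (inv₁-spec c₁ gc₁) Q₁∣J₁-I₁) ,
    congruent-in-range⇒≡ (proj₁ c₂-range) (proj₂ c₂-range) (proj₁ C₂-range) (proj₂ C₂-range)
      (inverses-congruent (+ c₂) (+ C₂) (inv₂ c₂) (inv₂ C₂) (inv₂-spec C₂ gC₂) (inv₂-spec c₂ gc₂) Q₀∣J₂-I₂)
    where
    Q₀∣Q : + Q₀ ∣ᶻ A * A′
    Q₀∣Q = ∣-resp-≡ (sym A*A′≡Q₀*Q₁) (ℤ∣.∣m⇒∣m*n (+ Q₁) ℤ∣.∣-refl)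
    Q₁∣Q : + Q₁ ∣ᶻ A * A′
    Q₁∣Q = ∣-resp-≡ (sym A*A′≡Q₀*Q₁) (ℤ∣.∣n⇒∣m*n (+ Q₀) ℤ∣.∣-refl)
    Q₁∣J₁-I₁ : + Q₁ ∣ᶻ inv₁ C₁ - inv₁ c₁
    Q₁∣J₁-I₁ = congruent-shift {s = S₁ c₁ c₂ b} {S₁ C₁ C₂ b} g₀₂ (A * A′) (S₁≡inv₁-mod-q₁ C₁ C₂ b) (S₁≡inv₁-mod-q₁ c₁ c₂ b) Q₁∣Q S≡
    Q₀∣b*[J₂-I₂] : + Q₀ ∣ᶻ + b * (inv₂ C₂ - inv₂ c₂)
    Q₀∣b*[J₂-I₂] = ∣-resp-≡ (factor (+ b) (inv₂ C₂) (inv₂ c₂))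
      (congruent-shift {s = S₁ c₁ c₂ b} {S₁ C₁ C₂ b} g₀₂ (A * A′) (S₁≡b*inv₂-mod-q₀ C₁ C₂ b) (S₁≡b*inv₂-mod-q₀ c₁ c₂ b) Q₀∣Q S≡)
      where
      factor : ∀ b J I → b * J - b * I ≡ b * (J - I)
      factor = solve-∀
    Q₀∣a′*[J₂-I₂] : + Q₀ ∣ᶻ A′ * (inv₂ C₂ - inv₂ c₂)
    Q₀∣a′*[J₂-I₂] = ∣-resp-≡ (sym (drop-vanishing (+ 1) (expand A′ (inv₂ C₂) (inv₂ c₂) g₁₂ (A * A′)) A′J₂≡))
      (ℤ∣.∣n⇒∣m*n g₁₂ Q₀∣Q)
      where
      expand : ∀ A′ J I g Q → A′ * (J - I) ≡ g * Q + (+ 1) * (A′ * J - (A′ * I + g * Q))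
      expand = solve-∀
    Q₀∣J₂-I₂ : + Q₀ ∣ᶻ inv₂ C₂ - inv₂ c₂
    Q₀∣J₂-I₂ = coprimeℤ₃-divisor (coprime-q₀-b-a′ {b} gb) Q₀∣b*[J₂-I₂] Q₀∣a′*[J₂-I₂]

-- Integral cosets between upper forms

private
  column-entry : ∀ g x y C N {Q} .{{_ : NonZero Q}}
    → g * (C * + Q) + x * (+ 0 * + Q) + y * (+ 0 * + Q) ≡ N * + Q → g * C ≡ N
  column-entry g x y C N {Q} e = ℤₚ.*-cancelʳ-≡ (g * C) N (+ Q) (trans (expand g x y C (+ Q)) e)
    where
    expand : ∀ g x y C Q → g * C * Q ≡ g * (C * Q) + x * (+ 0 * Q) + y * (+ 0 * Q)
    expand = solve-∀

  *-≡0⇒≡0 : ∀ {g} c .{{_ : NonZero c}} → g * + c ≡ + 0 → g ≡ + 0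
  *-≡0⇒≡0 {g} c e = ℤₚ.*-cancelʳ-≡ g (+ 0) (+ c) e

  *-≡+⇒≥0 : ∀ {g} n N → g * + ℕ.suc n ≡ + N → Σ ℕ λ m → g ≡ + m
  *-≡+⇒≥0 {+ m} _ _ _ = m , refl

  column-entry′ : ∀ {f} g y B C N {Q} .{{_ : NonZero Q}} → f ≡ + 0
    → f * (B * + Q) + g * (C * + Q) + y * (+ 0 * + Q) ≡ N * + Q → g * C ≡ N
  column-entry′ g y B C N {Q} refl e = column-entry g y (+ 0) C N (trans (expand g y B C (+ Q)) e)
    where
    expand : ∀ g y B C Q → g * (C * Q) + y * (+ 0 * Q) + + 0 * (+ 0 * Q) ≡ + 0 * (B * Q) + g * (C * Q) + y * (+ 0 * Q)
    expand = solve-∀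

  third-column : ∀ f g h S S′ Q {T} → f * S + g * S′ + h * (+ 1 * Q) ≡ T → T ≡ f * S + g * S′ + h * Q
  third-column f g h S S′ Q e = trans (sym e) (cong (λ t → f * S + g * S′ + h * t) (ℤₚ.*-identityˡ Q))

  detℤ-upper-triangular : ∀ γ → γ (suc zero) zero ≡ + 0 → γ (suc (suc zero)) zero ≡ + 0
    → γ (suc (suc zero)) (suc zero) ≡ + 0 → γ (suc (suc zero)) (suc (suc zero)) ≡ + 1
    → detℤ γ ≡ γ zero zero * γ (suc zero) (suc zero)
  detℤ-upper-triangular γ e₁₀ e₂₀ e₂₁ e₂₂ rewrite e₁₀ | e₂₀ | e₂₁ | e₂₂ =
    expand (γ zero zero) (γ zero (suc zero)) (γ zero (suc (suc zero))) (γ (suc zero) (suc zero)) (γ (suc zero) (suc (suc zero)))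
    where
    expand : ∀ g₀₀ g₀₁ g₀₂ g₁₁ g₁₂
      → g₀₀ * (g₁₁ * + 1 - g₁₂ * + 0) - g₀₁ * (+ 0 * + 1 - g₁₂ * + 0) + g₀₂ * (+ 0 * + 0 - g₁₁ * + 0) ≡ g₀₀ * g₁₁
    expand = solve-∀

upperForm-cosets-agree : ∀ γ {a a′ b A A′ B q : ℕ} {S₁ S₂ T₁ T₂ : ℤ} .{{_ : NonZero q}}
  → InΓ γ → γ ⊗ upperForm (+ ℕ.suc a) (+ ℕ.suc a′) (+ b) S₁ S₂ (+ q) ≐ upperForm (+ A) (+ A′) (+ B) T₁ T₂ (+ q)
  → 1 ≤ b → b ≤ ℕ.suc a′ → 1 ≤ B → B ≤ A′
  → ℕ.suc a ≡ A × ℕ.suc a′ ≡ A′ × b ≡ B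
  × Σ ℤ (λ g → T₂ ≡ S₂ + g * + q) × Σ ℤ (λ g → T₁ ≡ S₁ + g * + q)
upperForm-cosets-agree γ {a} {a′} {b} {A} {A′} {B} {q} {S₁} {S₂} {T₁} {T₂} det≡1 γX≐Y 1≤b b≤a′ 1≤B B≤A′ =
  a≡A , a′≡A′ , b≡B , (g₁₂ , T₂≡) , (g₀₂ , T₁≡)
  where
  Q α α′ g₀₀ g₀₁ g₀₂ g₁₀ g₁₁ g₁₂ g₂₀ g₂₁ g₂₂ : ℤ
  Q = + q
  α = + ℕ.suc a
  α′ = + ℕ.suc a′
  g₀₀ = γ zero zero
  g₀₁ = γ zero (suc zero)
  g₀₂ = γ zero (suc (suc zero))
  g₁₀ = γ (suc zero) zero
  g₁₁ = γ (suc zero) (suc zero)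
  g₁₂ = γ (suc zero) (suc (suc zero))
  g₂₀ = γ (suc (suc zero)) zero
  g₂₁ = γ (suc (suc zero)) (suc zero)
  g₂₂ = γ (suc (suc zero)) (suc (suc zero))

  g₁₀≡0 : g₁₀ ≡ + 0
  g₁₀≡0 = *-≡0⇒≡0 (ℕ.suc a) (column-entry g₁₀ g₁₁ g₁₂ α (+ 0) (γX≐Y (suc zero) zero))

  g₂₀≡0 : g₂₀ ≡ + 0
  g₂₀≡0 = *-≡0⇒≡0 (ℕ.suc a) (column-entry g₂₀ g₂₁ g₂₂ α (+ 0) (γX≐Y (suc (suc zero)) zero))

  g₂₁≡0 : g₂₁ ≡ + 0
  g₂₁≡0 = *-≡0⇒≡0 (ℕ.suc a′) (column-entry′ g₂₁ g₂₂ (+ b) α′ (+ 0) g₂₀≡0 (γX≐Y (suc (suc zero)) (suc zero)))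

  g₂₂≡1 : g₂₂ ≡ + 1
  g₂₂≡1 = ℤₚ.*-cancelʳ-≡ g₂₂ (+ 1) Q (sym (trans (third-column g₂₀ g₂₁ g₂₂ S₁ S₂ Q (γX≐Y (suc (suc zero)) (suc (suc zero))))
    (trans (cong₂ (λ u v → u * S₁ + v * S₂ + g₂₂ * Q) g₂₀≡0 g₂₁≡0) (simplify S₁ S₂ g₂₂ Q))))
    where
    simplify : ∀ S₁ S₂ g Q → + 0 * S₁ + + 0 * S₂ + g * Q ≡ g * Q
    simplify = solve-∀

  g₀₀*a≡A : g₀₀ * α ≡ + A
  g₀₀*a≡A = column-entry g₀₀ g₀₁ g₀₂ α (+ A) (γX≐Y zero zero)

  g₁₁*a′≡A′ : g₁₁ * α′ ≡ + A′
  g₁₁*a′≡A′ = column-entry′ g₁₁ g₁₂ (+ b) α′ (+ A′) g₁₀≡0 (γX≐Y (suc zero) (suc zero))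

  unit-diagonal : Σ ℕ (λ m → g₀₀ ≡ + m) → Σ ℕ (λ m → g₁₁ ≡ + m) → g₀₀ ≡ + 1 × g₁₁ ≡ + 1
  unit-diagonal (m , g₀₀≡m) (m′ , g₁₁≡m′) =
    trans g₀₀≡m (cong +_ (ℕₚ.m*n≡1⇒m≡1 m m′ m*m′≡1)) , trans g₁₁≡m′ (cong +_ (ℕₚ.m*n≡1⇒n≡1 m m′ m*m′≡1))
    where
    m*m′≡1 : m ℕ.* m′ ≡ 1
    m*m′≡1 = cong Data.Integer.∣_∣ (trans (ℤₚ.pos-* m m′) (trans (cong₂ _*_ (sym g₀₀≡m) (sym g₁₁≡m′))
      (trans (sym (detℤ-upper-triangular γ g₁₀≡0 g₂₀≡0 g₂₁≡0 g₂₂≡1)) det≡1)))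

  g₀₀≡1 : g₀₀ ≡ + 1
  g₀₀≡1 = proj₁ (unit-diagonal (*-≡+⇒≥0 a A g₀₀*a≡A) (*-≡+⇒≥0 a′ A′ g₁₁*a′≡A′))

  g₁₁≡1 : g₁₁ ≡ + 1
  g₁₁≡1 = proj₂ (unit-diagonal (*-≡+⇒≥0 a A g₀₀*a≡A) (*-≡+⇒≥0 a′ A′ g₁₁*a′≡A′))

  a≡A : ℕ.suc a ≡ A
  a≡A = cong Data.Integer.∣_∣ (trans (sym (ℤₚ.*-identityˡ α)) (trans (cong (_* α) (sym g₀₀≡1)) g₀₀*a≡A))

  a′≡A′ : ℕ.suc a′ ≡ A′
  a′≡A′ = cong Data.Integer.∣_∣ (trans (sym (ℤₚ.*-identityˡ α′)) (trans (cong (_* α′) (sym g₁₁≡1)) g₁₁*a′≡A′))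

  b+g₀₁*a′≡B : + b + g₀₁ * α′ ≡ + B
  b+g₀₁*a′≡B = ℤₚ.*-cancelʳ-≡ _ _ Q (drop-vanishing₂ (+ 1) (- (+ b * Q))
    (expand (+ b) (+ B) g₀₀ g₀₁ g₀₂ α′ Q) (γX≐Y zero (suc zero)) g₀₀≡1)
    where
    expand : ∀ b B g₀₀ g₀₁ g₀₂ α′ Q → (b + g₀₁ * α′) * Q
      ≡ B * Q + (+ 1) * (g₀₀ * (b * Q) + g₀₁ * (α′ * Q) + g₀₂ * (+ 0 * Q) - B * Q) + (- (b * Q)) * (g₀₀ - + 1)
    expand = solve-∀

  b≡B : b ≡ B
  b≡B = congruent-in-range⇒≡ 1≤b b≤a′ 1≤B (subst (B ≤_) (sym a′≡A′) B≤A′)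
    (divides (- g₀₁) (drop-vanishing (+ 1) (expand (+ b) (+ B) g₀₁ α′) b+g₀₁*a′≡B))
    where
    expand : ∀ b B g α′ → b - B ≡ (- g) * α′ + (+ 1) * (b + g * α′ - B)
    expand = solve-∀

  g₀₁≡0 : g₀₁ ≡ + 0
  g₀₁≡0 = *-≡0⇒≡0 (ℕ.suc a′) (drop-vanishing₂ (+ 1) (- + 1) (expand (+ b) (+ B) g₀₁ α′) b+g₀₁*a′≡B (cong +_ b≡B))
    where
    expand : ∀ b B g α′ → g * α′ ≡ + 0 + (+ 1) * (b + g * α′ - B) + (- + 1) * (b - B)
    expand = solve-∀

  T₂≡ : T₂ ≡ S₂ + g₁₂ * Q
  T₂≡ = trans (third-column g₁₀ g₁₁ g₁₂ S₁ S₂ Q (γX≐Y (suc zero) (suc (suc zero))))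
    (trans (cong₂ (λ u v → u * S₁ + v * S₂ + g₁₂ * Q) g₁₀≡0 g₁₁≡1) (simplify S₁ S₂ g₁₂ Q))
    where
    simplify : ∀ S₁ S₂ g Q → + 0 * S₁ + + 1 * S₂ + g * Q ≡ S₂ + g * Q
    simplify = solve-∀

  T₁≡ : T₁ ≡ S₁ + g₀₂ * Q
  T₁≡ = trans (third-column g₀₀ g₀₁ g₀₂ S₁ S₂ Q (γX≐Y zero (suc (suc zero))))
    (trans (cong₂ (λ u v → u * S₁ + v * S₂ + g₀₂ * Q) g₀₀≡1 g₀₁≡0) (simplify S₁ S₂ g₀₂ Q))
    where
    simplify : ∀ S₁ S₂ g Q → + 1 * S₁ + + 0 * S₂ + g * Q ≡ S₁ + g * Q
    simplify = solve-∀

-- The bijection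

module Numerators (k : ℕ) (ℓ₀ ℓ₁ : ℕ → ℤ) (inv₁ inv₂ : ℕ → ℕ → ℤ) where
  open Scaling k

  s₁-numerator : ℕ → ℕ → ℕ → ℕ → ℤ
  s₁-numerator a c₁ c₂ b = inv₁ a c₁ * + q₀ (suc k) a * ℓ₀ a + + b * inv₂ a c₂ * + q₁ (suc k) a * ℓ₁ a

  numerators : Tup → Mat ℤ
  numerators (tup a a′ c₁ c₂ b) = upperForm (+ a) (+ a′) (+ b) (s₁-numerator a c₁ c₂ b) (+ a′ * inv₂ a c₂) (+ suc k)

  imageMat≐scaled : ∀ t → imageMat (suc k) ℓ₀ ℓ₁ inv₁ inv₂ t ≐ scaled (numerators t)
  imageMat≐scaled (tup a a′ c₁ c₂ b) zero zero = toℚ≡scaled (+ a)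
  imageMat≐scaled (tup a a′ c₁ c₂ b) zero (suc zero) = toℚ≡scaled (+ b)
  imageMat≐scaled (tup a a′ c₁ c₂ b) zero (suc (suc zero)) = refl
  imageMat≐scaled (tup a a′ c₁ c₂ b) (suc zero) zero = toℚ≡scaled (+ 0)
  imageMat≐scaled (tup a a′ c₁ c₂ b) (suc zero) (suc zero) = toℚ≡scaled (+ a′)
  imageMat≐scaled (tup a a′ c₁ c₂ b) (suc zero) (suc (suc zero)) = refl
  imageMat≐scaled (tup a a′ c₁ c₂ b) (suc (suc zero)) zero = toℚ≡scaled (+ 0)
  imageMat≐scaled (tup a a′ c₁ c₂ b) (suc (suc zero)) (suc zero) = toℚ≡scaled (+ 0)
  imageMat≐scaled (tup a a′ c₁ c₂ b) (suc (suc zero)) (suc (suc zero)) = toℚ≡scaled (+ 1)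

  nD≐scaled : ∀ p₁ p₂ → nD (suc k) p₁ p₂ ≐ scaled (lowerForm (+ p₁) (+ p₂) (+ suc k))
  nD≐scaled p₁ p₂ zero zero = toℚ≡scaled (+ suc k)
  nD≐scaled p₁ p₂ zero (suc zero) = toℚ≡scaled (+ 0)
  nD≐scaled p₁ p₂ zero (suc (suc zero)) = toℚ≡scaled (+ 0)
  nD≐scaled p₁ p₂ (suc zero) zero = toℚ≡scaled (+ 0)
  nD≐scaled p₁ p₂ (suc zero) (suc zero) = toℚ≡scaled (+ suc k)
  nD≐scaled p₁ p₂ (suc zero) (suc (suc zero)) = toℚ≡scaled (+ 0)
  nD≐scaled p₁ p₂ (suc (suc zero)) zero = toℚ≡scaled (+ p₁)
  nD≐scaled p₁ p₂ (suc (suc zero)) (suc zero) = toℚ≡scaled (+ p₂)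
  nD≐scaled p₁ p₂ (suc (suc zero)) (suc (suc zero)) = refl

module Bijection (k : ℕ) (ℓ₀ ℓ₁ : ℕ → ℤ)
  (bézout : ∀ a → a ∣ suc k → + q₀ (suc k) a * ℓ₀ a + + q₁ (suc k) a * ℓ₁ a ≡ + 1)
  (inv₁ inv₂ : ℕ → ℕ → ℤ)
  (inv₁-spec : ∀ a c → a ∣ suc k → gcd c (q₁ (suc k) a) ≡ 1 → + q₁ (suc k) a ∣ℤ (+ c * inv₁ a c - + 1))
  (inv₂-spec : ∀ a c → a ∣ suc k → gcd c (q₀ (suc k) a) ≡ 1 → + q₀ (suc k) a ∣ℤ (+ c * inv₂ a c - + 1))
  where

  private
    q : ℕ
    q = suc k
    image : Tup → Mat ℚ
    image = imageMat q ℓ₀ ℓ₁ inv₁ inv₂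
  open Scaling k
  open Numerators k ℓ₀ ℓ₁ inv₁ inv₂

  module AtDivisor (a a′ : ℕ) (a*a′≡q : a ℕ.* a′ ≡ q) where

    a∣q : a ∣ q
    a∣q = ℕD.divides a′ (trans (sym a*a′≡q) (ℕₚ.*-comm a a′))

    open DivisorQ₀ k a a∣q
    open PerDivisor a a′ (q₀ q a) (q₁ q a) ⦃ subst NonZero (sym a*a′≡q) _ ⦄ (ℓ₀ a) (ℓ₁ a) (inv₁ a) (inv₂ a)
      (trans q₀*q₁≡q (sym a*a′≡q)) coprime-q₀-q₁ a∣q₀ divisor-of-q₀-coprime-to-a (bézout a a∣q)
      (λ c gcd≡1 → ℤ∣.∣ᵤ⇒∣ (inv₁-spec a c a∣q gcd≡1)) (λ c gcd≡1 → ℤ∣.∣ᵤ⇒∣ (inv₂-spec a c a∣q gcd≡1)) public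

    q≡a*a′ : + q ≡ + a * + a′
    q≡a*a′ = trans (cong +_ (sym a*a′≡q)) (ℤₚ.pos-* a a′)

    lift⇒sameCoset : ∀ {c₁ c₂ b p₁ p₂} → Lift (+ a) (+ a′) (+ b) (inv₂ a c₂) (S₁ c₁ c₂ b) (+ p₁) (+ p₂)
      → SameCoset (image (tup a a′ c₁ c₂ b)) (nD q p₁ p₂)
    lift⇒sameCoset {c₁} {c₂} {b} {p₁} {p₂} L =
      integralCoset⇒sameCoset {M = X (+ q)} {N = Y (+ q)} (imageMat≐scaled (tup a a′ c₁ c₂ b)) (nD≐scaled p₁ p₂)
        (subst (λ Q → IntegralCoset (X Q) (Y Q)) (sym q≡a*a′) (lift⇒integralCoset L))
      where
      X Y : ℤ → Mat ℤ
      X = upperForm (+ a) (+ a′) (+ b) (S₁ c₁ c₂ b) (+ a′ * inv₂ a c₂)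
      Y = lowerForm (+ p₁) (+ p₂)

  image-in-ℛ : (t : Tup) → InQ q t → Σ ℕ λ p₁ → Σ ℕ λ p₂ → InR q p₁ p₂ × SameCoset (image t) (nD q p₁ p₂)
  image-in-ℛ (tup a a′ c₁ c₂ b) (a*a′≡q , admissible) =
    let p₁ , p₂ , p∈ℛ , L = tuple⇒lift admissible
    in p₁ , p₂ , subst (λ n → InR n p₁ p₂) a*a′≡q p∈ℛ , lift⇒sameCoset L
    where open AtDivisor a a′ a*a′≡q

  surjective : (p₁ p₂ : ℕ) → InR q p₁ p₂ → Σ Tup λ t → InQ q t × SameCoset (image t) (nD q p₁ p₂)
  surjective p₁ p₂ (_ , _ , gcd[p₁,p₂,q]≡1) =
    let c₁ , c₂ , b , admissible , L = point⇒tuple p₁≡p₁′*a (ℕC.coprime-/gcd p₁ q)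
                                         (subst (λ n → gcd (gcd p₁ p₂) n ≡ 1) (sym a*a′≡q) gcd[p₁,p₂,q]≡1)
    in tup a a′ c₁ c₂ b , (a*a′≡q , admissible) , lift⇒sameCoset L
    where
    a : ℕ
    a = gcd p₁ q
    instance
      a≢0 : NonZero a
      a≢0 = ℕ.≢-nonZero (ℕG.gcd[m,n]≢0 p₁ q (inj₂ λ ()))
    a′ : ℕ
    a′ = q ℕDM./ a
    a*a′≡q : a ℕ.* a′ ≡ q
    a*a′≡q = ℕDM.m*[n/m]≡n (ℕG.gcd[m,n]∣n p₁ q)
    p₁≡p₁′*a : p₁ ≡ p₁ ℕDM./ a ℕ.* a
    p₁≡p₁′*a = sym (ℕDM.m/n*n≡m (ℕG.gcd[m,n]∣m p₁ q))
    open AtDivisor a a′ a*a′≡q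

  private
    invariants-determine-tuple : ∀ {a a′ c₁ c₂ b A A′ C₁ C₂ B} → InQ q (tup a a′ c₁ c₂ b) → InQ q (tup A A′ C₁ C₂ B)
      → a ≡ A × a′ ≡ A′ × b ≡ B
      × Σ ℤ (λ g → + A′ * inv₂ A C₂ ≡ + a′ * inv₂ a c₂ + g * + q)
      × Σ ℤ (λ g → s₁-numerator A C₁ C₂ B ≡ s₁-numerator a c₁ c₂ b + g * + q)
      → tup a a′ c₁ c₂ b ≡ tup A A′ C₁ C₂ B
    invariants-determine-tuple {a} {a′} {c₁} {c₂} {b} {C₁ = C₁} {C₂} (a*a′≡q , admissible) (_ , admissible′)
             (refl , refl , refl , (g₁₂ , T₂≡) , (g₀₂ , T₁≡)) =
      same-cs (congruent-numerators⇒c≡ g₁₂ g₀₂ admissible admissible′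
        (subst (λ Q → + a′ * inv₂ a C₂ ≡ + a′ * inv₂ a c₂ + g₁₂ * Q) q≡a*a′ T₂≡)
        (subst (λ Q → s₁-numerator a C₁ C₂ b ≡ s₁-numerator a c₁ c₂ b + g₀₂ * Q) q≡a*a′ T₁≡))
      where
      open AtDivisor a a′ a*a′≡q
      same-cs : ∀ {c₁ c₂ C₁ C₂ b} → c₁ ≡ C₁ × c₂ ≡ C₂ → tup a a′ c₁ c₂ b ≡ tup a a′ C₁ C₂ b
      same-cs (refl , refl) = refl

  injective : (t t′ : Tup) → InQ q t → InQ q t′ → SameCoset (image t) (image t′) → t ≡ t′
  injective (tup zero _ _ _ _) _ (() , _) _ _
  injective (tup (suc a) zero _ _ _) _ (a*0≡q , _) _ _ = ⊥-elim (ℕₚ.0≢1+n (trans (sym (ℕₚ.*-zeroʳ (suc a))) a*0≡q))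
  injective t@(tup (suc a) (suc a′) _ _ _) t′@(tup _ A′ _ _ _)
            t∈Q@(_ , _ , _ , (1≤b , b≤a′) , _) t′∈Q@(_ , _ , _ , (1≤B , B≤A′) , _) same =
    invariants (sameCoset⇒integralCoset {M = numerators t} {N = numerators t′} (imageMat≐scaled t) (imageMat≐scaled t′) same)
    where
    invariants : IntegralCoset (numerators t) (numerators t′) → t ≡ t′
    invariants (γ , det≡1 , γX≐Y) = invariants-determine-tuple t∈Q t′∈Q (upperForm-cosets-agree γ det≡1 γX≐Y 1≤b b≤a′ 1≤B B≤A′)

lemma2p4 : (q : ℕ) → .{{_ : NonZero q}}
    → (ℓ₀ ℓ₁ : ℕ → ℤ)
    → (∀ a → a ∣ q → + q₀ q a * ℓ₀ a Data.Integer.+ + q₁ q a * ℓ₁ a ≡ + 1)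
    → (inv₁ inv₂ : ℕ → ℕ → ℤ)
    → (∀ a c → a ∣ q → gcd c (q₁ q a) ≡ 1 → + q₁ q a ∣ℤ (+ c * inv₁ a c - + 1))
    → (∀ a c → a ∣ q → gcd c (q₀ q a) ≡ 1 → + q₀ q a ∣ℤ (+ c * inv₂ a c - + 1))
    → ((t : Tup) → InQ q t
         → Σ ℕ λ p₁ → Σ ℕ λ p₂ → InR q p₁ p₂
             × SameCoset (imageMat q ℓ₀ ℓ₁ inv₁ inv₂ t) (nD q p₁ p₂))
    × ((t t′ : Tup) → InQ q t → InQ q t′
         → SameCoset (imageMat q ℓ₀ ℓ₁ inv₁ inv₂ t) (imageMat q ℓ₀ ℓ₁ inv₁ inv₂ t′)
         → t ≡ t′)
    × ((p₁ p₂ : ℕ) → InR q p₁ p₂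
         → Σ Tup λ t → InQ q t
             × SameCoset (imageMat q ℓ₀ ℓ₁ inv₁ inv₂ t) (nD q p₁ p₂))
lemma2p4 (suc k) ℓ₀ ℓ₁ bézout inv₁ inv₂ inv₁-spec inv₂-spec = image-in-ℛ , injective , surjective
  where open Bijection k ℓ₀ ℓ₁ bézout inv₁ inv₂ inv₁-spec inv₂-spec
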